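{- Let $r,n$ be positive integers, $W=C_r\wr S_n$, let $Y$ be a nonempty subset of $W$ with dual distance distribution $(A'_k)_{0\le k\le n}$, and let $t$ be an integer with $1\le t\le n$. If $Y$ is a $t$-design, then $A'_k=0$ for all $k$ with $1\le k\le t$. Conversely, if $t\le n/2$ and $A'_k=0$ for all $k$ with $1\le k\le t$, then $Y$ is a $t$-design.
   Context: $C_r=\mathbb{Z}/r\mathbb{Z}$; $[n]=\{1,\dots,n\}$. $W=C_r\wr S_n$ consists of pairs $(g,\pi)$, $g\in C_r^n$, $\pi\in S_n$, with $(f,\pi)(g,\sigma)=(f+g^\pi,\pi\sigma)$, $g^\pi=(g_{\pi^{ -1}(1)},\dots,g_{\pi^{ -1}(n)})$, acting on $C_r\times[n]$ by $(g,\pi)\cdot(c,i)=(c+g_{\pi(i)},\pi(i))$. $Y$ is a $t$-design if there is $c>0$ such that for any two $t$-tuples $((c_1,i_1),\dots,(c_t,i_t))$, $((c'_1,i'_1),\dots,(c'_t,i'_t))$ of elements of $C_r\times[n]$, each with pairwise distinct second coordinates, exactly $c$ elements of $Y$ map the first tuple to the second componentwise. For $g\in W$, $\theta(g)=\frac1r|\{(c,i):g(c,i)=(c,i)\}|$. The Charlier polynomial is $C^{(a)}_k(x)=\sum_{j=0}^k(-1)^{k-j}\binom kj a^{ -j}x(x-1)\cdots(x-j+1)$. The dual distance distribution of $Y$ is $A'_k=\frac{1}{|Y|}\sum_{x,y\in Y}C^{(1/r)}_k(\theta(x^{ -1}y))$, $0\le k\le n$. -}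

module Defs where

open import Data.Nat as ℕ using (ℕ; zero; suc; NonZero)
open import Data.Nat.DivMod using (_mod_)
open import Data.Nat.Combinatorics using (_C_)
open import Data.Fin as Fin using (Fin; toℕ)
open import Data.Fin.Properties using (all?) renaming (_≟_ to _≟ᶠ_)
open import Data.Fin.Permutation using (Permutation′; _⟨$⟩ʳ_; _⟨$⟩ˡ_; _∘ₚ_; flip)
open import Data.Integer as ℤ using (ℤ; +_)
open import Data.Rational as ℚ using (ℚ; 0ℚ; 1ℚ; _+_; _*_; _-_; -_; _/_)
open import Data.List as List using (List; []; _∷_; length; filter; foldr; map; allFin; concatMap)
open import Data.Product using (_×_; _,_; proj₁; proj₂)
open import Data.Product.Properties using (≡-dec)
open import Relation.Nullary using (¬_; Dec)
open import Relation.Binary.PropositionalEquality using (_≡_; _≢_)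
open import Function.Definitions using (Injective)

Cyc : ℕ → Set
Cyc r = Fin r

module _ (r : ℕ) .{{_ : NonZero r}} where

  _⊕_ : Cyc r → Cyc r → Cyc r
  a ⊕ b = (toℕ a ℕ.+ toℕ b) mod r

  ⊖_ : Cyc r → Cyc r
  ⊖ a = (r ℕ.∸ toℕ a) mod r

  0c : Cyc r
  0c = 0 mod r

-- The wreath product W = C_r ≀ S_n : pairs (g , π)

W : ℕ → ℕ → Set
W r n = (Fin n → Cyc r) × Permutation′ n

perm : ∀ {n} → Permutation′ n → Fin n → Fin n
perm π i = π ⟨$⟩ʳ i

_≈W_ : ∀ {r n} → W r n → W r n → Set
(f , π) ≈W (g , σ) = (∀ i → f i ≡ g i) × (∀ i → perm π i ≡ perm σ i)

-- a list of elements of W without repetitions (a finite subset of W)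
UniqueW : ∀ {r n} → List (W r n) → Set
UniqueW [] = Data.Unit.⊤ where import Data.Unit
UniqueW (x ∷ xs) = AllNot x xs × UniqueW xs
  where
  AllNot : _ → List _ → Set
  AllNot x [] = Data.Unit.⊤ where import Data.Unit
  AllNot x (y ∷ ys) = (¬ (x ≈W y)) × AllNot x ys

module _ {r n : ℕ} .{{_ : NonZero r}} where

  twist : (Fin n → Cyc r) → Permutation′ n → (Fin n → Cyc r)
  twist g π i = g (π ⟨$⟩ˡ i)

  -- (f,π)(g,σ) = (f + g^π , πσ), where (πσ)(i) = π(σ(i))
  _·W_ : W r n → W r n → W r n
  (f , π) ·W (g , σ) = (λ i → _⊕_ r (f i) (twist g π i)) , (σ ∘ₚ π)

  invW : W r n → W r n
  invW (g , π) = (λ i → ⊖_ r (g (perm π i))) , flip π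

  act : W r n → Cyc r × Fin n → Cyc r × Fin n
  act (g , π) (c , i) = _⊕_ r c (g (perm π i)) , perm π i

  countL : ∀ {A : Set} {P : A → Set} → (∀ x → Dec (P x)) → List A → ℕ
  countL P? xs = length (filter P? xs)

  points : List (Cyc r × Fin n)
  points = concatMap (λ c → map (c ,_) (allFin n)) (allFin r)

  θ : W r n → ℚ
  θ g = (+ countL (λ p → ≡-dec _≟ᶠ_ _≟ᶠ_ (act g p) p) points) / r

  transportCount : ∀ {t} → List (W r n) → (Fin t → Cyc r × Fin n) → (Fin t → Cyc r × Fin n) → ℕ
  transportCount Y xs ys =
    countL (λ y → all? (λ j → ≡-dec _≟ᶠ_ _≟ᶠ_ (act y (xs j)) (ys j))) Y

  IsDesign : ℕ → List (W r n) → Set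
  IsDesign t Y = Data.Product.Σ ℕ λ c → (0 ℕ.< c) ×
    ((xs ys : Fin t → Cyc r × Fin n) →
      Injective _≡_ _≡_ (λ j → proj₂ (xs j)) →
      Injective _≡_ _≡_ (λ j → proj₂ (ys j)) →
      transportCount Y xs ys ≡ c)
    where import Data.Product

-- Charlier polynomials.  The parameter is given as a⁻¹ (so that no
-- nonzero-ness proof for a is needed):
--   C^{(a)}_k(x) = Σ_{j=0}^k (-1)^{k-j} (k choose j) a^{-j} x(x-1)...(x-j+1)

_^ℚ_ : ℚ → ℕ → ℚ
x ^ℚ zero = 1ℚ
x ^ℚ suc k = x * (x ^ℚ k)

falling : ℚ → ℕ → ℚ
falling x zero = 1ℚ
falling x (suc j) = falling x j * (x - (+ j / 1))

sumTo : ℕ → (ℕ → ℚ) → ℚ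
sumTo zero f = f 0
sumTo (suc m) f = sumTo m f + f (suc m)

charlier : (a⁻¹ : ℚ) → ℕ → ℚ → ℚ
charlier a⁻¹ k x =
  sumTo k (λ j → ((- 1ℚ) ^ℚ (k ℕ.∸ j)) * ((+ (k C j) / 1) * ((a⁻¹ ^ℚ j) * falling x j)))

sumℚ : List ℚ → ℚ
sumℚ = foldr _+_ 0ℚ

dualDist : (r n : ℕ) .{{_ : NonZero r}} (Y : List (W r n)) .{{_ : NonZero (length Y)}} → ℕ → ℚ
dualDist r n Y k =
  (+ 1 / length Y) *
  sumℚ (concatMap (λ x → map (λ y → charlier (+ r / 1) k (θ (invW x ·W y))) Y) Y)

{-# OPTIONS --safe #-}
-- Let Ωⱼ be the set of j-tuples of points of C_r × [n] lying in pairwise distinct fibres, and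
-- N(ω, ω′) the number of y ∈ Y with y ω = ω′; Y is a j-design iff N is constant on Ωⱼ × Ωⱼ.
-- An element g fixes r^j θ(g) (θ(g) − 1) ⋯ (θ(g) − j + 1) tuples of Ωⱼ, and x⁻¹y fixes ω iff
-- x ω = y ω, so
--   Sⱼ := Σ_{x,y ∈ Y} r^j θ(x⁻¹y) (θ(x⁻¹y) − 1) ⋯ (θ(x⁻¹y) − j + 1) = Σ_{ω,ω′ ∈ Ωⱼ} N(ω, ω′)²,
-- and the definition of the Charlier polynomials makes |Y| A′ₖ the binomial transform
-- Σ_{j ≤ k} (−1)^{k−j} C(k, j) Sⱼ.  Every row of N sums to |Y|, so by Cauchy–Schwarz
-- Sⱼ ≥ |Y|² = S₀, with equality iff Y is a j-design.  A t-design is a j-design for every j ≤ t,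
-- and then the alternating binomial sums make A′ₖ vanish for 1 ≤ k ≤ t.  Conversely the
-- binomial transform is unitriangular, so A′₁ = ⋯ = A′ₜ = 0 forces S_t = S₀ = |Y|².
module Submission where

open import Defs
open import Data.Nat using (ℕ; NonZero; _≤_; _*_)
open import Data.List using (List; length)
open import Data.Rational using (0ℚ)
open import Data.Product using (_×_)
open import Relation.Binary.PropositionalEquality using (_≡_)

open import Algebra.Bundles using (AbelianGroup; CommutativeMonoid; CommutativeRing)
open import Data.Fin using (Fin; toℕ; inject≤)
open import Data.Fin.Permutation using (_⟨$⟩ʳ_; _⟨$⟩ˡ_; inverseˡ; inverseʳ)
open import Data.Fin.Properties using (toℕ-fromℕ<; fromℕ<-cong; toℕ-injective; toℕ<n; inject≤-injective)
  renaming (_≟_ to _≟ᶠ_)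
import Data.Integer as ℤ
import Data.Integer.Properties as ℤP
open import Data.List using ([]; _∷_; _++_; map; filter; concatMap; allFin; cartesianProduct; cartesianProductWith)
import Data.List.Properties as ListP
open import Data.List.Membership.Propositional using (_∈_)
open import Data.List.Membership.Propositional.Properties
  using (∈-allFin; ∈-cartesianProduct⁺; ∈-cartesianProductWith⁺; ∈-filter⁺; ∈-filter⁻)
import Data.List.Relation.Unary.All as ListAll
open import Data.List.Relation.Unary.All using ([]; _∷_)
open import Data.List.Relation.Unary.Any using (here; there)
open import Data.List.Relation.Unary.Unique.Propositional using (Unique; []; _∷_)
open import Data.List.Relation.Unary.Unique.Propositional.Properties
  using (allFin⁺; cartesianProduct⁺; cartesianProductWith⁺; filter⁺)
open import Data.Nat using (zero; suc; _+_; _∸_; _^_; _<_; z≤n; s≤s; z<s; ∣_-_∣; _%_; >-nonZero⁻¹)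
open import Data.Nat.Combinatorics using (_C_; nCn≡1)
open import Data.Nat.Combinatorics.Base using (_P′_)
open import Data.Nat.DivMod using (_mod_; %-distribˡ-+; m%n%n≡m%n; m<n⇒m%n≡m; n%n≡0)
import Data.Nat.Properties as ℕP
open import Data.Nat.Tactic.RingSolver using (solve-∀)
open import Data.Product using (_,_; proj₁; proj₂; uncurry; Σ; ∃-syntax)
open import Data.Product.Properties using (≡-dec)
open import Data.Rational as ℚ using (ℚ; 1ℚ; _/_; toℚᵘ)
import Data.Rational.Properties as ℚP
open import Data.Rational.Unnormalised using (mkℚᵘ; *≡*) renaming (_≃_ to _≃ᵘ_)
import Data.Rational.Unnormalised.Properties as ℚᵘP
open import Data.Sum using (inj₁; inj₂)
open import Data.Vec as Vec using (Vec; []; _∷_; tabulate; lookup)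
open import Data.Vec.Properties
  using (∷-injective; map-id; map-cong; map-∘; lookup-map; tabulate-∘; tabulate-cong; lookup∘tabulate; tabulate∘lookup)
  renaming (≡-dec to ≡-decᵥ)
open import Data.Vec.Relation.Unary.All as All using (All; []; _∷_)
open import Data.Vec.Relation.Unary.AllPairs using (allPairs?; []; _∷_)
open import Data.Vec.Relation.Unary.Unique.Propositional using () renaming (Unique to Uniqueᵥ)
open import Data.Vec.Relation.Unary.Unique.Propositional.Properties using (tabulate⁺; lookup-injective)
open import Function using (_∘_)
open import Function.Definitions using (Injective)
open import Level using (0ℓ)
open import Relation.Nullary using (Dec; yes; no; ¬_; ¬?; contradiction)
open import Relation.Nullary.Decidable using (_×-dec_)
open import Relation.Binary.Definitions using (DecidableEquality)
open import Relation.Binary.PropositionalEquality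
  using (_≢_; refl; sym; trans; cong; cong₂; subst; isEquivalence; module ≡-Reasoning)
open ≡-Reasoning

-- Indicators and finite sums

𝟙 : ∀ {p} {P : Set p} → Dec P → ℕ
𝟙 (yes _) = 1
𝟙 (no _)  = 0

module _ {p} {P : Set p} where

  𝟙-yes : P → (d : Dec P) → 𝟙 d ≡ 1
  𝟙-yes _ (yes _) = refl
  𝟙-yes x (no ¬x) = contradiction x ¬x

  𝟙-no : ¬ P → (d : Dec P) → 𝟙 d ≡ 0
  𝟙-no ¬x (yes x) = contradiction x ¬x
  𝟙-no _  (no _)  = refl

  𝟙-¬?+𝟙 : (d : Dec P) → 𝟙 (¬? d) + 𝟙 d ≡ 1
  𝟙-¬?+𝟙 (yes _) = refl
  𝟙-¬?+𝟙 (no _)  = refl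

  𝟙-*-cong : (d : Dec P) {a b : ℕ} → (P → a ≡ b) → 𝟙 d * a ≡ 𝟙 d * b
  𝟙-*-cong (yes x) a≡b = cong (1 *_) (a≡b x)
  𝟙-*-cong (no _)  _   = refl

  𝟙>0⇒ : (d : Dec P) → 0 < 𝟙 d → P
  𝟙>0⇒ (yes x) _ = x

module _ {p q} {P : Set p} {Q : Set q} where

  𝟙-cong : (P → Q) → (Q → P) → (d : Dec P) (e : Dec Q) → 𝟙 d ≡ 𝟙 e
  𝟙-cong to from (yes x) e = sym (𝟙-yes (to x) e)
  𝟙-cong to from (no ¬x) e = sym (𝟙-no (λ y → ¬x (from y)) e)

  𝟙-×-dec : (d : Dec P) (e : Dec Q) → 𝟙 (d ×-dec e) ≡ 𝟙 d * 𝟙 e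
  𝟙-×-dec (yes _) (yes _) = refl
  𝟙-×-dec (yes _) (no _)  = refl
  𝟙-×-dec (no _)  _       = refl

𝟙-split : ∀ {p q s} {P : Set p} {Q : Set q} {R : Set s} → (R → P × Q) → (P × Q → R) →
          (d : Dec R) (e : Dec P) (f : Dec Q) → 𝟙 d ≡ 𝟙 e * 𝟙 f
𝟙-split to from d e f = trans (𝟙-cong to from d (e ×-dec f)) (𝟙-×-dec e f)

∑ : ∀ {A : Set} → List A → (A → ℕ) → ℕ
∑ []       f = 0
∑ (x ∷ xs) f = f x + ∑ xs f

syntax ∑ xs (λ x → e) = ∑[ x ∈ xs ] e

module _ {A : Set} where

  ∑-cong : ∀ (xs : List A) {f g : A → ℕ} → (∀ x → f x ≡ g x) → ∑ xs f ≡ ∑ xs g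
  ∑-cong []       f≗g = refl
  ∑-cong (x ∷ xs) f≗g = cong₂ _+_ (f≗g x) (∑-cong xs f≗g)

  ∑-cong-∈ : ∀ (xs : List A) {f g : A → ℕ} → (∀ {x} → x ∈ xs → f x ≡ g x) → ∑ xs f ≡ ∑ xs g
  ∑-cong-∈ []       f≗g = refl
  ∑-cong-∈ (x ∷ xs) f≗g = cong₂ _+_ (f≗g (here refl)) (∑-cong-∈ xs (λ x∈xs → f≗g (there x∈xs)))

  ∑-+ : ∀ (xs : List A) (f g : A → ℕ) → ∑[ x ∈ xs ] (f x + g x) ≡ ∑ xs f + ∑ xs g
  ∑-+ []       f g = refl
  ∑-+ (x ∷ xs) f g = begin
    f x + g x + ∑[ x ∈ xs ] (f x + g x) ≡⟨ cong (f x + g x +_) (∑-+ xs f g) ⟩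
    f x + g x + (∑ xs f + ∑ xs g)       ≡⟨ interchange (f x) (g x) (∑ xs f) (∑ xs g) ⟩
    f x + ∑ xs f + (g x + ∑ xs g)       ∎
    where interchange : ∀ a b c d → a + b + (c + d) ≡ a + c + (b + d)
          interchange = solve-∀

  ∑-*ˡ : ∀ (xs : List A) (a : ℕ) (f : A → ℕ) → ∑[ x ∈ xs ] (a * f x) ≡ a * ∑ xs f
  ∑-*ˡ []       a f = sym (ℕP.*-zeroʳ a)
  ∑-*ˡ (x ∷ xs) a f = trans (cong (a * f x +_) (∑-*ˡ xs a f)) (sym (ℕP.*-distribˡ-+ a (f x) (∑ xs f)))

  ∑-*ʳ : ∀ (xs : List A) (a : ℕ) (f : A → ℕ) → ∑[ x ∈ xs ] (f x * a) ≡ ∑ xs f * a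
  ∑-*ʳ xs a f = begin
    ∑[ x ∈ xs ] (f x * a) ≡⟨ ∑-cong xs (λ x → ℕP.*-comm (f x) a) ⟩
    ∑[ x ∈ xs ] (a * f x) ≡⟨ ∑-*ˡ xs a f ⟩
    a * ∑ xs f            ≡⟨ ℕP.*-comm a (∑ xs f) ⟩
    ∑ xs f * a            ∎

  ∑-const : ∀ (xs : List A) (a : ℕ) → ∑[ x ∈ xs ] a ≡ length xs * a
  ∑-const []       a = refl
  ∑-const (x ∷ xs) a = cong (a +_) (∑-const xs a)

  ∑-1 : ∀ (xs : List A) → ∑[ x ∈ xs ] 1 ≡ length xs
  ∑-1 xs = trans (∑-const xs 1) (ℕP.*-identityʳ (length xs))

  ∑-++ : ∀ (xs ys : List A) (f : A → ℕ) → ∑ (xs ++ ys) f ≡ ∑ xs f + ∑ ys f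
  ∑-++ []       ys f = refl
  ∑-++ (x ∷ xs) ys f = trans (cong (f x +_) (∑-++ xs ys f)) (sym (ℕP.+-assoc (f x) (∑ xs f) (∑ ys f)))

  ∑-filter : ∀ {p} {P : A → Set p} (P? : ∀ x → Dec (P x)) (xs : List A) (f : A → ℕ) →
             ∑ (filter P? xs) f ≡ ∑[ x ∈ xs ] (𝟙 (P? x) * f x)
  ∑-filter P? []       f = refl
  ∑-filter P? (x ∷ xs) f with P? x
  ... | yes _ = cong₂ _+_ (sym (ℕP.+-identityʳ (f x))) (∑-filter P? xs f)
  ... | no  _ = ∑-filter P? xs f

  length-filter : ∀ {p} {P : A → Set p} (P? : ∀ x → Dec (P x)) (xs : List A) →
                  length (filter P? xs) ≡ ∑[ x ∈ xs ] 𝟙 (P? x)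
  length-filter P? xs = begin
    length (filter P? xs)       ≡⟨ ∑-1 (filter P? xs) ⟨
    ∑[ x ∈ filter P? xs ] 1     ≡⟨ ∑-filter P? xs (λ _ → 1) ⟩
    ∑[ x ∈ xs ] (𝟙 (P? x) * 1)  ≡⟨ ∑-cong xs (λ x → ℕP.*-identityʳ (𝟙 (P? x))) ⟩
    ∑[ x ∈ xs ] 𝟙 (P? x)        ∎

  ∑≡0⇒ : ∀ {xs : List A} {f : A → ℕ} → ∑ xs f ≡ 0 → ∀ {x} → x ∈ xs → f x ≡ 0
  ∑≡0⇒ {_ ∷ _} ∑≡0 (here refl)  = ℕP.m+n≡0⇒m≡0 _ ∑≡0
  ∑≡0⇒ {_ ∷ _} ∑≡0 (there x∈xs) = ∑≡0⇒ (ℕP.m+n≡0⇒n≡0 _ ∑≡0) x∈xs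

  ∑-pos : ∀ (xs : List A) (f : A → ℕ) → 0 < ∑ xs f → ∃[ x ] 0 < f x
  ∑-pos (x ∷ xs) f pos with f x in fx
  ... | zero  = ∑-pos xs f pos
  ... | suc _ = x , subst (0 <_) (sym fx) z<s

  ∑-δ : ∀ (_≟_ : DecidableEquality A) {xs : List A} {v : A} → Unique xs → v ∈ xs →
        (h : A → ℕ) → ∑[ x ∈ xs ] (𝟙 (v ≟ x) * h x) ≡ h v
  ∑-δ _≟_ {v ∷ xs} (v∉xs ∷ _) (here refl) h = begin
    𝟙 (v ≟ v) * h v + ∑[ x ∈ xs ] (𝟙 (v ≟ x) * h x) ≡⟨ cong₂ _+_ (cong (_* h v) (𝟙-yes refl (v ≟ v))) (absent v∉xs) ⟩
    1 * h v + 0                                      ≡⟨ trans (ℕP.+-identityʳ (1 * h v)) (ℕP.*-identityˡ (h v)) ⟩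
    h v                                              ∎
    where
    absent : ∀ {xs} → ListAll.All (v ≢_) xs → ∑[ x ∈ xs ] (𝟙 (v ≟ x) * h x) ≡ 0
    absent []            = refl
    absent (v≢x ∷ v∉xs) = cong₂ _+_ (cong (_* h _) (𝟙-no v≢x (v ≟ _))) (absent v∉xs)
  ∑-δ _≟_ {y ∷ _} {v} (y∉xs ∷ unique) (there v∈xs) h =
    cong₂ _+_ (cong (_* h y) (𝟙-no (λ v≡y → ListAll.lookup y∉xs v∈xs (sym v≡y)) (v ≟ y))) (∑-δ _≟_ unique v∈xs h)

module _ {A B : Set} where

  ∑-map : ∀ (g : A → B) (xs : List A) (f : B → ℕ) → ∑ (map g xs) f ≡ ∑[ x ∈ xs ] f (g x)
  ∑-map g []       f = refl
  ∑-map g (x ∷ xs) f = cong (f (g x) +_) (∑-map g xs f)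

  ∑-comm : ∀ (xs : List A) (ys : List B) (f : A → B → ℕ) →
           ∑[ x ∈ xs ] ∑[ y ∈ ys ] f x y ≡ ∑[ y ∈ ys ] ∑[ x ∈ xs ] f x y
  ∑-comm []       ys f = sym (trans (∑-const ys 0) (ℕP.*-zeroʳ (length ys)))
  ∑-comm (x ∷ xs) ys f = begin
    ∑ ys (f x) + ∑[ x ∈ xs ] ∑[ y ∈ ys ] f x y ≡⟨ cong (∑ ys (f x) +_) (∑-comm xs ys f) ⟩
    ∑ ys (f x) + ∑[ y ∈ ys ] ∑[ x ∈ xs ] f x y ≡⟨ ∑-+ ys (f x) _ ⟨
    ∑[ y ∈ ys ] (f x y + ∑[ x ∈ xs ] f x y)    ∎

  ∑²-comm : ∀ (xs : List A) (zs : List B) (f : A → A → B → ℕ) →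
            ∑[ x ∈ xs ] ∑[ y ∈ xs ] ∑[ z ∈ zs ] f x y z ≡ ∑[ z ∈ zs ] ∑[ x ∈ xs ] ∑[ y ∈ xs ] f x y z
  ∑²-comm xs zs f = trans (∑-cong xs (λ x → ∑-comm xs zs (f x))) (∑-comm xs zs _)

  ∑-*-∑ : ∀ (xs : List A) (ys : List B) (f : A → ℕ) (g : B → ℕ) →
          ∑ xs f * ∑ ys g ≡ ∑[ x ∈ xs ] ∑[ y ∈ ys ] (f x * g y)
  ∑-*-∑ xs ys f g = begin
    ∑ xs f * ∑ ys g                     ≡⟨ ∑-*ʳ xs (∑ ys g) f ⟨
    ∑[ x ∈ xs ] (f x * ∑ ys g)          ≡⟨ ∑-cong xs (λ x → ∑-*ˡ ys (f x) g) ⟨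
    ∑[ x ∈ xs ] ∑[ y ∈ ys ] (f x * g y) ∎

module _ {A B C : Set} (g : A → B → C) where

  ∑-cartesianProductWith : ∀ (xs : List A) (ys : List B) (f : C → ℕ) →
                           ∑ (cartesianProductWith g xs ys) f ≡ ∑[ x ∈ xs ] ∑[ y ∈ ys ] f (g x y)
  ∑-cartesianProductWith []       ys f = refl
  ∑-cartesianProductWith (x ∷ xs) ys f = begin
    ∑ (map (g x) ys ++ cartesianProductWith g xs ys) f      ≡⟨ ∑-++ (map (g x) ys) _ f ⟩
    ∑ (map (g x) ys) f + ∑ (cartesianProductWith g xs ys) f ≡⟨ cong₂ _+_ (∑-map (g x) ys f) (∑-cartesianProductWith xs ys f) ⟩
    ∑[ y ∈ ys ] f (g x y) + ∑[ x ∈ xs ] ∑[ y ∈ ys ] f (g x y) ∎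

  concatMap-map≡cartesianProductWith : ∀ (xs : List A) (ys : List B) →
                                       concatMap (λ x → map (g x) ys) xs ≡ cartesianProductWith g xs ys
  concatMap-map≡cartesianProductWith []       ys = refl
  concatMap-map≡cartesianProductWith (x ∷ xs) ys = cong (map (g x) ys ++_) (concatMap-map≡cartesianProductWith xs ys)

  map-cartesianProductWith : ∀ {D : Set} (h : C → D) (xs : List A) (ys : List B) →
                             map h (cartesianProductWith g xs ys) ≡ cartesianProductWith (λ x y → h (g x y)) xs ys
  map-cartesianProductWith h []       ys = refl
  map-cartesianProductWith h (x ∷ xs) ys = begin
    map h (map (g x) ys ++ cartesianProductWith g xs ys)
      ≡⟨ ListP.map-++ h (map (g x) ys) _ ⟩
    map h (map (g x) ys) ++ map h (cartesianProductWith g xs ys)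
      ≡⟨ cong₂ _++_ (sym (ListP.map-∘ ys)) (map-cartesianProductWith h xs ys) ⟩
    map (λ y → h (g x y)) ys ++ cartesianProductWith (λ x y → h (g x y)) xs ys ∎

-- Cauchy–Schwarz

∣m-n∣²+2mn≡m²+n² : ∀ m n → ∣ m - n ∣ * ∣ m - n ∣ + 2 * (m * n) ≡ m * m + n * n
∣m-n∣²+2mn≡m²+n² zero    n       = ℕP.+-identityʳ (n * n)
∣m-n∣²+2mn≡m²+n² (suc m) zero    = cong (suc m * suc m +_) (cong (2 *_) (ℕP.*-zeroʳ (suc m)))
∣m-n∣²+2mn≡m²+n² (suc m) (suc n) = begin
  ∣ m - n ∣ * ∣ m - n ∣ + 2 * (suc m * suc n)             ≡⟨ expand (∣ m - n ∣ * ∣ m - n ∣) m n ⟩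
  ∣ m - n ∣ * ∣ m - n ∣ + 2 * (m * n) + 2 * (1 + m + n)   ≡⟨ cong (_+ 2 * (1 + m + n)) (∣m-n∣²+2mn≡m²+n² m n) ⟩
  m * m + n * n + 2 * (1 + m + n)                         ≡⟨ collect m n ⟩
  suc m * suc m + suc n * suc n                           ∎
  where
  expand : ∀ d m n → d + 2 * ((1 + m) * (1 + n)) ≡ d + 2 * (m * n) + 2 * (1 + m + n)
  expand = solve-∀
  collect : ∀ m n → m * m + n * n + 2 * (1 + m + n) ≡ (1 + m) * (1 + m) + (1 + n) * (1 + n)
  collect = solve-∀

module _ {A : Set} where

  ∑-lagrange : ∀ (xs : List A) (a : A → ℕ) →
    ∑[ u ∈ xs ] ∑[ v ∈ xs ] (∣ a u - a v ∣ * ∣ a u - a v ∣) + 2 * (∑ xs a * ∑ xs a)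
      ≡ 2 * (length xs * ∑[ u ∈ xs ] (a u * a u))
  ∑-lagrange xs a = begin
    D + 2 * (∑ xs a * ∑ xs a)
      ≡⟨ cong (λ s → D + 2 * s) (∑-*-∑ xs xs a a) ⟩
    D + 2 * ∑[ u ∈ xs ] ∑[ v ∈ xs ] (a u * a v)
      ≡⟨ cong (D +_) (trans (∑-cong xs (λ u → ∑-*ˡ xs 2 _)) (∑-*ˡ xs 2 _)) ⟨
    D + ∑[ u ∈ xs ] ∑[ v ∈ xs ] (2 * (a u * a v))
      ≡⟨ trans (∑-cong xs (λ u → ∑-+ xs _ _)) (∑-+ xs _ _) ⟨
    ∑[ u ∈ xs ] ∑[ v ∈ xs ] (∣ a u - a v ∣ * ∣ a u - a v ∣ + 2 * (a u * a v))
      ≡⟨ ∑-cong xs (λ u → ∑-cong xs (λ v → ∣m-n∣²+2mn≡m²+n² (a u) (a v))) ⟩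
    ∑[ u ∈ xs ] ∑[ v ∈ xs ] (a u * a u + a v * a v)
      ≡⟨ ∑-cong xs (λ u → trans (∑-+ xs _ _) (cong (_+ Q) (∑-const xs (a u * a u)))) ⟩
    ∑[ u ∈ xs ] (length xs * (a u * a u) + Q)
      ≡⟨ trans (∑-+ xs _ _) (cong₂ _+_ (∑-*ˡ xs (length xs) _) (∑-const xs Q)) ⟩
    length xs * Q + length xs * Q
      ≡⟨ cong (length xs * Q +_) (ℕP.+-identityʳ (length xs * Q)) ⟨
    2 * (length xs * Q) ∎
    where
    D = ∑[ u ∈ xs ] ∑[ v ∈ xs ] (∣ a u - a v ∣ * ∣ a u - a v ∣)
    Q = ∑[ u ∈ xs ] (a u * a u)

  cauchySchwarz-tight⇒constant : ∀ {xs : List A} (a : A → ℕ) →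
    length xs * ∑[ u ∈ xs ] (a u * a u) ≡ ∑ xs a * ∑ xs a → ∀ {u v} → u ∈ xs → v ∈ xs → a u ≡ a v
  cauchySchwarz-tight⇒constant {xs} a tight u∈xs v∈xs =
    ℕP.∣m-n∣≡0⇒m≡n (square≡0 (∑≡0⇒ (∑≡0⇒ D≡0 u∈xs) v∈xs))
    where
    D≡0 : ∑[ u ∈ xs ] ∑[ v ∈ xs ] (∣ a u - a v ∣ * ∣ a u - a v ∣) ≡ 0
    D≡0 = ℕP.+-cancelʳ-≡ _ _ 0 (trans (∑-lagrange xs a) (cong (2 *_) tight))
    square≡0 : ∀ {d} → d * d ≡ 0 → d ≡ 0
    square≡0 {zero} _ = refl

-- The embedding ℕ → ℚ and binomial transforms

ι : ℕ → ℚ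
ι n = ℤ.+ n / 1

toℚᵘ-ι : ∀ n → toℚᵘ (ι n) ≃ᵘ mkℚᵘ (ℤ.+ n) 0
toℚᵘ-ι n = ℚP.toℚᵘ-fromℚᵘ (mkℚᵘ (ℤ.+ n) 0)

ι-+ : ∀ m n → ι (m + n) ≡ ι m ℚ.+ ι n
ι-+ m n = ℚP.toℚᵘ-injective (ℚᵘP.≃-trans (toℚᵘ-ι (m + n)) (ℚᵘP.≃-sym (ℚᵘP.≃-trans
  (ℚP.toℚᵘ-homo-+ (ι m) (ι n)) (ℚᵘP.≃-trans (ℚᵘP.+-cong (toℚᵘ-ι m) (toℚᵘ-ι n)) (*≡* numerators)))))
  where
  numerators : (ℤ.+ m ℤ.* ℤ.+ 1 ℤ.+ ℤ.+ n ℤ.* ℤ.+ 1) ℤ.* ℤ.+ 1 ≡ (ℤ.+ m ℤ.+ ℤ.+ n) ℤ.* ℤ.+ 1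
  numerators = cong (ℤ._* ℤ.+ 1) (cong₂ ℤ._+_ (ℤP.*-identityʳ (ℤ.+ m)) (ℤP.*-identityʳ (ℤ.+ n)))

ι-* : ∀ m n → ι (m * n) ≡ ι m ℚ.* ι n
ι-* m n = ℚP.toℚᵘ-injective (ℚᵘP.≃-trans (toℚᵘ-ι (m * n)) (ℚᵘP.≃-sym (ℚᵘP.≃-trans
  (ℚP.toℚᵘ-homo-* (ι m) (ι n)) (ℚᵘP.≃-trans (ℚᵘP.*-cong (toℚᵘ-ι m) (toℚᵘ-ι n))
  (ℚᵘP.≃-reflexive (cong (λ z → mkℚᵘ z 0) (sym (ℤP.pos-* m n))))))))

ι-injective : ∀ {m n} → ι m ≡ ι n → m ≡ n
ι-injective {m} {n} ιm≡ιn
  with ℚᵘP.≃-trans (ℚᵘP.≃-sym (toℚᵘ-ι m)) (ℚᵘP.≃-trans (ℚP.toℚᵘ-cong ιm≡ιn) (toℚᵘ-ι n))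
... | *≡* eq = ℤP.+-injective (trans (sym (ℤP.*-identityʳ (ℤ.+ m))) (trans eq (ℤP.*-identityʳ (ℤ.+ n))))

ι-∸ : ∀ {m n} → n ≤ m → ι (m ∸ n) ≡ ι m ℚ.- ι n
ι-∸ {m} {n} n≤m = begin
  ι (m ∸ n)                   ≡⟨ //-rightDividesʳ (ι n) (ι (m ∸ n)) ⟨
  ι (m ∸ n) ℚ.+ ι n ℚ.- ι n   ≡⟨ cong (ℚ._- ι n) (trans (sym (ι-+ (m ∸ n) n)) (cong ι (ℕP.m∸n+n≡m n≤m))) ⟩
  ι m ℚ.- ι n                 ∎
  where open import Algebra.Properties.Group ℚP.+-0-group using (//-rightDividesʳ)

ι-^ : ∀ m j → ι (m ^ j) ≡ ι m ^ℚ j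
ι-^ m zero    = refl
ι-^ m (suc j) = trans (ι-* m (m ^ j)) (cong (ι m ℚ.*_) (ι-^ m j))

P′-vanishes : ∀ {m j} → m < j → m P′ j ≡ 0
P′-vanishes {m} {suc j} (s≤s m≤j) with ℕP.m≤n⇒m<n∨m≡n m≤j
... | inj₁ m<j  = trans (cong ((m ∸ j) *_) (P′-vanishes m<j)) (ℕP.*-zeroʳ (m ∸ j))
... | inj₂ refl = cong (_* (m P′ m)) (ℕP.n∸n≡0 m)

ι-P′ : ∀ m j → ι (m P′ j) ≡ falling (ι m) j
ι-P′ m zero    = refl
ι-P′ m (suc j) = begin
  ι ((m ∸ j) * (m P′ j))             ≡⟨ trans (cong ι (ℕP.*-comm (m ∸ j) (m P′ j))) (ι-* (m P′ j) (m ∸ j)) ⟩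
  ι (m P′ j) ℚ.* ι (m ∸ j)           ≡⟨ lastFactor ⟩
  ι (m P′ j) ℚ.* (ι m ℚ.- ι j)       ≡⟨ cong (ℚ._* (ι m ℚ.- ι j)) (ι-P′ m j) ⟩
  falling (ι m) j ℚ.* (ι m ℚ.- ι j)  ∎
  where
  lastFactor : ι (m P′ j) ℚ.* ι (m ∸ j) ≡ ι (m P′ j) ℚ.* (ι m ℚ.- ι j)
  lastFactor with ℕP.≤-<-connex j m
  ... | inj₁ j≤m = cong (ι (m P′ j) ℚ.*_) (ι-∸ j≤m)
  ... | inj₂ m<j rewrite P′-vanishes m<j = trans (ℚP.*-zeroˡ (ι (m ∸ j))) (sym (ℚP.*-zeroˡ (ι m ℚ.- ι j)))

ι-∑ : ∀ {A : Set} (xs : List A) (f : A → ℕ) → ι (∑ xs f) ≡ sumℚ (map (ι ∘ f) xs)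
ι-∑ []       f = refl
ι-∑ (x ∷ xs) f = trans (ι-+ (f x) (∑ xs f)) (cong (ι (f x) ℚ.+_) (ι-∑ xs f))

+[r*m]/r≡ι[m] : ∀ r .{{_ : NonZero r}} m → ℤ.+ (r * m) / r ≡ ι m
+[r*m]/r≡ι[m] r@(suc r-1) m = ℚP.toℚᵘ-injective (ℚᵘP.≃-trans
  (ℚP.toℚᵘ-fromℚᵘ (mkℚᵘ (ℤ.+ (r * m)) r-1)) (ℚᵘP.≃-trans (*≡* cross) (ℚᵘP.≃-sym (toℚᵘ-ι m))))
  where
  cross : ℤ.+ (r * m) ℤ.* ℤ.+ 1 ≡ ℤ.+ m ℤ.* ℤ.+ r
  cross = trans (ℤP.*-identityʳ _) (trans (ℤP.pos-* r m) (ℤP.*-comm (ℤ.+ r) (ℤ.+ m)))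

ι[n]*1/n≡1 : ∀ n .{{_ : NonZero n}} → ι n ℚ.* (ℤ.+ 1 / n) ≡ 1ℚ
ι[n]*1/n≡1 n@(suc n-1) = ℚP.toℚᵘ-injective (ℚᵘP.≃-trans (ℚP.toℚᵘ-homo-* (ι n) (ℤ.+ 1 / n))
  (ℚᵘP.≃-trans (ℚᵘP.*-cong (toℚᵘ-ι n) (ℚP.toℚᵘ-fromℚᵘ (mkℚᵘ (ℤ.+ 1) n-1))) (*≡* cross)))
  where
  cross : (ℤ.+ n ℤ.* ℤ.+ 1) ℤ.* ℤ.+ 1 ≡ ℤ.+ 1 ℤ.* ℤ.+ (1 * n)
  cross = trans (ℤP.*-identityʳ _) (trans (ℤP.*-identityʳ _)
    (trans (cong ℤ.+_ (sym (ℕP.*-identityˡ n))) (sym (ℤP.*-identityˡ _))))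

1/n*q≡0⇒q≡0 : ∀ n .{{_ : NonZero n}} q → (ℤ.+ 1 / n) ℚ.* q ≡ 0ℚ → q ≡ 0ℚ
1/n*q≡0⇒q≡0 n q 1/n*q≡0 = begin
  q                              ≡⟨ ℚP.*-identityˡ q ⟨
  1ℚ ℚ.* q                       ≡⟨ cong (ℚ._* q) (ι[n]*1/n≡1 n) ⟨
  ι n ℚ.* (ℤ.+ 1 / n) ℚ.* q      ≡⟨ ℚP.*-assoc (ι n) (ℤ.+ 1 / n) q ⟩
  ι n ℚ.* ((ℤ.+ 1 / n) ℚ.* q)    ≡⟨ cong (ι n ℚ.*_) 1/n*q≡0 ⟩
  ι n ℚ.* 0ℚ                     ≡⟨ ℚP.*-zeroʳ (ι n) ⟩
  0ℚ                             ∎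

signedBinomial : ℕ → ℕ → ℚ → ℚ
signedBinomial k j x = (ℚ.- 1ℚ) ^ℚ (k ∸ j) ℚ.* (ι (k C j) ℚ.* x)

-- charlier a k x is by definition binomialTransform (λ j → a ^ℚ j ℚ.* falling x j) k.
binomialTransform : (ℕ → ℚ) → ℕ → ℚ
binomialTransform f k = sumTo k (λ j → signedBinomial k j (f j))

sumTo-cong≤ : ∀ k {f g : ℕ → ℚ} → (∀ j → j ≤ k → f j ≡ g j) → sumTo k f ≡ sumTo k g
sumTo-cong≤ zero    f≗g = f≗g 0 z≤n
sumTo-cong≤ (suc k) f≗g =
  cong₂ ℚ._+_ (sumTo-cong≤ k (λ j j≤k → f≗g j (ℕP.m≤n⇒m≤1+n j≤k))) (f≗g (suc k) ℕP.≤-refl)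

sumTo-+ : ∀ k (f g : ℕ → ℚ) → sumTo k f ℚ.+ sumTo k g ≡ sumTo k (λ j → f j ℚ.+ g j)
sumTo-+ zero    f g = refl
sumTo-+ (suc k) f g = trans (interchange (sumTo k f) (f (suc k)) (sumTo k g) (g (suc k)))
                            (cong (ℚ._+ (f (suc k) ℚ.+ g (suc k))) (sumTo-+ k f g))
  where
  open import Algebra.Properties.CommutativeSemigroup (CommutativeMonoid.commutativeSemigroup ℚP.+-0-commutativeMonoid)
    using (interchange)

sumTo-0 : ∀ k → sumTo k (λ _ → 0ℚ) ≡ 0ℚ
sumTo-0 zero    = refl
sumTo-0 (suc k) = trans (ℚP.+-identityʳ _) (sumTo-0 k)

signedBinomial-+ : ∀ k j x y → signedBinomial k j x ℚ.+ signedBinomial k j y ≡ signedBinomial k j (x ℚ.+ y)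
signedBinomial-+ k j x y = begin
  s ℚ.* (c ℚ.* x) ℚ.+ s ℚ.* (c ℚ.* y) ≡⟨ ℚP.*-distribˡ-+ s (c ℚ.* x) (c ℚ.* y) ⟨
  s ℚ.* (c ℚ.* x ℚ.+ c ℚ.* y)         ≡⟨ cong (s ℚ.*_) (ℚP.*-distribˡ-+ c x y) ⟨
  s ℚ.* (c ℚ.* (x ℚ.+ y))             ∎
  where s = (ℚ.- 1ℚ) ^ℚ (k ∸ j); c = ι (k C j)

signedBinomial-0 : ∀ k j → signedBinomial k j 0ℚ ≡ 0ℚ
signedBinomial-0 k j = trans (cong ((ℚ.- 1ℚ) ^ℚ (k ∸ j) ℚ.*_) (ℚP.*-zeroʳ (ι (k C j)))) (ℚP.*-zeroʳ ((ℚ.- 1ℚ) ^ℚ (k ∸ j)))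

binomialTransform-cong≤ : ∀ k {f g : ℕ → ℚ} → (∀ j → j ≤ k → f j ≡ g j) →
                          binomialTransform f k ≡ binomialTransform g k
binomialTransform-cong≤ k f≗g = sumTo-cong≤ k (λ j j≤k → cong (signedBinomial k j) (f≗g j j≤k))

sumℚ-binomialTransform : ∀ {A : Set} (xs : List A) (f : A → ℕ → ℚ) k →
  sumℚ (map (λ x → binomialTransform (f x) k) xs) ≡ binomialTransform (λ j → sumℚ (map (λ x → f x j) xs)) k
sumℚ-binomialTransform []       f k = sym (trans (sumTo-cong≤ k (λ j _ → signedBinomial-0 k j)) (sumTo-0 k))
sumℚ-binomialTransform (x ∷ xs) f k = begin
  binomialTransform (f x) k ℚ.+ sumℚ (map (λ x → binomialTransform (f x) k) xs)
    ≡⟨ cong (binomialTransform (f x) k ℚ.+_) (sumℚ-binomialTransform xs f k) ⟩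
  binomialTransform (f x) k ℚ.+ binomialTransform (λ j → sumℚ (map (λ x → f x j) xs)) k
    ≡⟨ sumTo-+ k _ _ ⟩
  sumTo k (λ j → signedBinomial k j (f x j) ℚ.+ signedBinomial k j (sumℚ (map (λ x → f x j) xs)))
    ≡⟨ sumTo-cong≤ k (λ j _ → signedBinomial-+ k j _ _) ⟩
  binomialTransform (λ j → f x j ℚ.+ sumℚ (map (λ x → f x j) xs)) k ∎

binomialTransform-suc : ∀ (f : ℕ → ℚ) k →
  binomialTransform f (suc k) ≡ sumTo k (λ j → signedBinomial (suc k) j (f j)) ℚ.+ f (suc k)
binomialTransform-suc f k = cong (sumTo k (λ j → signedBinomial (suc k) j (f j)) ℚ.+_) (begin
  (ℚ.- 1ℚ) ^ℚ (k ∸ k) ℚ.* (ι (suc k C suc k) ℚ.* f (suc k))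
    ≡⟨ cong₂ (λ e c → (ℚ.- 1ℚ) ^ℚ e ℚ.* (ι c ℚ.* f (suc k))) (ℕP.n∸n≡0 k) (nCn≡1 (suc k)) ⟩
  1ℚ ℚ.* (1ℚ ℚ.* f (suc k))
    ≡⟨ trans (ℚP.*-identityˡ _) (ℚP.*-identityˡ (f (suc k))) ⟩
  f (suc k) ∎)

module _ where
  open import Data.Fin using (fromℕ; inject₁)
  open import Data.Fin.Properties using (toℕ-inject₁; toℕ-fromℕ)
  open CommutativeRing ℚP.+-*-commutativeRing using (semiring; commutativeSemiring)
  open import Algebra.Properties.Semiring.Sum semiring using (sum; sum-init-last; sum-cong-≗; *-distribʳ-sum)
  import Algebra.Properties.Semiring.Exp semiring as Exp
  import Algebra.Properties.Semiring.Mult semiring as Mult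
  open import Algebra.Properties.CommutativeSemiring.Binomial commutativeSemiring using (binomialTerm; theorem)
  open import Algebra.Properties.CommutativeSemigroup (CommutativeMonoid.commutativeSemigroup ℚP.*-1-commutativeMonoid)
    using (xy∙z≈y∙xz)

  sumTo≡sum : ∀ k (h : ℕ → ℚ) → sumTo k h ≡ sum (λ (i : Fin (suc k)) → h (toℕ i))
  sumTo≡sum zero    h = sym (ℚP.+-identityʳ (h 0))
  sumTo≡sum (suc k) h = begin
    sumTo k h ℚ.+ h (suc k)
      ≡⟨ cong₂ ℚ._+_ (sumTo≡sum k h) (cong h (sym (toℕ-fromℕ (suc k)))) ⟩
    sum (λ (i : Fin (suc k)) → h (toℕ i)) ℚ.+ h (toℕ (fromℕ (suc k)))
      ≡⟨ cong (ℚ._+ h (toℕ (fromℕ (suc k)))) (sum-cong-≗ {suc k} (λ i → cong h (sym (toℕ-inject₁ i)))) ⟩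
    sum (λ (i : Fin (suc k)) → h (toℕ (inject₁ i))) ℚ.+ h (toℕ (fromℕ (suc k)))
      ≡⟨ sum-init-last (λ (i : Fin (suc (suc k))) → h (toℕ i)) ⟨
    sum (λ (i : Fin (suc (suc k))) → h (toℕ i)) ∎

  ^≡^ℚ : ∀ x n → x Exp.^ n ≡ x ^ℚ n
  ^≡^ℚ x zero    = refl
  ^≡^ℚ x (suc n) = cong (x ℚ.*_) (^≡^ℚ x n)

  1^ℚn≡1 : ∀ n → 1ℚ ^ℚ n ≡ 1ℚ
  1^ℚn≡1 zero    = refl
  1^ℚn≡1 (suc n) = trans (ℚP.*-identityˡ _) (1^ℚn≡1 n)

  ×≡ι* : ∀ n x → n Mult.× x ≡ ι n ℚ.* x
  ×≡ι* zero    x = sym (ℚP.*-zeroˡ x)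
  ×≡ι* (suc n) x = begin
    x ℚ.+ n Mult.× x        ≡⟨ cong₂ ℚ._+_ (sym (ℚP.*-identityˡ x)) (×≡ι* n x) ⟩
    1ℚ ℚ.* x ℚ.+ ι n ℚ.* x  ≡⟨ ℚP.*-distribʳ-+ x 1ℚ (ι n) ⟨
    (1ℚ ℚ.+ ι n) ℚ.* x      ≡⟨ cong (ℚ._* x) (ι-+ 1 n) ⟨
    ι (suc n) ℚ.* x         ∎

  binomialTransform-const : ∀ q k → binomialTransform (λ _ → q) (suc k) ≡ 0ℚ
  binomialTransform-const q k = begin
    binomialTransform (λ _ → q) (suc k)
      ≡⟨ sumTo≡sum (suc k) (λ j → signedBinomial (suc k) j q) ⟩
    sum (λ (i : Fin (suc (suc k))) → signedBinomial (suc k) (toℕ i) q)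
      ≡⟨ sum-cong-≗ {suc (suc k)} (λ i → term (toℕ i)) ⟩
    sum (λ i → binomialTerm 1ℚ (ℚ.- 1ℚ) (suc k) i ℚ.* q)
      ≡⟨ *-distribʳ-sum q (binomialTerm 1ℚ (ℚ.- 1ℚ) (suc k)) ⟨
    sum (binomialTerm 1ℚ (ℚ.- 1ℚ) (suc k)) ℚ.* q
      ≡⟨ cong (ℚ._* q) (theorem (suc k) 1ℚ (ℚ.- 1ℚ)) ⟨
    (1ℚ ℚ.- 1ℚ) Exp.^ suc k ℚ.* q
      ≡⟨ cong (λ x → x ℚ.* (1ℚ ℚ.- 1ℚ) Exp.^ k ℚ.* q) (ℚP.+-inverseʳ 1ℚ) ⟩
    0ℚ ℚ.* (1ℚ ℚ.- 1ℚ) Exp.^ k ℚ.* q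
      ≡⟨ trans (cong (ℚ._* q) (ℚP.*-zeroˡ ((1ℚ ℚ.- 1ℚ) Exp.^ k))) (ℚP.*-zeroˡ q) ⟩
    0ℚ ∎
    where
    term : ∀ j → signedBinomial (suc k) j q ≡ ((suc k C j) Mult.× (1ℚ Exp.^ j ℚ.* (ℚ.- 1ℚ) Exp.^ (suc k ∸ j))) ℚ.* q
    term j = sym (begin
      ((suc k C j) Mult.× (1ℚ Exp.^ j ℚ.* s Exp.^ e)) ℚ.* q
        ≡⟨ cong (ℚ._* q) (×≡ι* (suc k C j) _) ⟩
      (ι (suc k C j) ℚ.* (1ℚ Exp.^ j ℚ.* s Exp.^ e)) ℚ.* q
        ≡⟨ cong (λ x → ι (suc k C j) ℚ.* x ℚ.* q) (cong₂ ℚ._*_ (trans (^≡^ℚ 1ℚ j) (1^ℚn≡1 j)) (^≡^ℚ s e)) ⟩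
      (ι (suc k C j) ℚ.* (1ℚ ℚ.* s ^ℚ e)) ℚ.* q
        ≡⟨ cong (λ x → ι (suc k C j) ℚ.* x ℚ.* q) (ℚP.*-identityˡ (s ^ℚ e)) ⟩
      (ι (suc k C j) ℚ.* s ^ℚ e) ℚ.* q
        ≡⟨ xy∙z≈y∙xz (ι (suc k C j)) (s ^ℚ e) q ⟩
      s ^ℚ e ℚ.* (ι (suc k C j) ℚ.* q) ∎)
      where s = ℚ.- 1ℚ; e = suc k ∸ j

constant⇒binomialTransform-vanishes : ∀ {f : ℕ → ℚ} {q} k → (∀ j → j ≤ suc k → f j ≡ q) →
                                      binomialTransform f (suc k) ≡ 0ℚ
constant⇒binomialTransform-vanishes {q = q} k f≡q =
  trans (binomialTransform-cong≤ (suc k) f≡q) (binomialTransform-const q k)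

binomialTransform-vanishes⇒constant : ∀ {f : ℕ → ℚ} t → (∀ k → 1 ≤ k → k ≤ t → binomialTransform f k ≡ 0ℚ) →
                                      ∀ j → j ≤ t → f j ≡ f 0
binomialTransform-vanishes⇒constant {f} t vanishes j j≤t = upTo j j≤t j ℕP.≤-refl
  where
  open import Algebra.Properties.Group ℚP.+-0-group using (∙-cancelˡ)
  upTo : ∀ k → k ≤ t → ∀ j → j ≤ k → f j ≡ f 0
  upTo zero    _    .zero z≤n = refl
  upTo (suc k) sk≤t j   j≤sk with ℕP.m≤n⇒m<n∨m≡n j≤sk
  ... | inj₁ (s≤s j≤k) = upTo k (ℕP.≤-trans (ℕP.n≤1+n k) sk≤t) j j≤k
  ... | inj₂ refl      = ∙-cancelˡ lower (f (suc k)) (f 0) (begin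
    lower ℚ.+ f (suc k)
      ≡⟨ cong (ℚ._+ f (suc k)) (sumTo-cong≤ k (λ i i≤k →
           cong (signedBinomial (suc k) i) (sym (upTo k (ℕP.≤-trans (ℕP.n≤1+n k) sk≤t) i i≤k)))) ⟩
    sumTo k (λ i → signedBinomial (suc k) i (f i)) ℚ.+ f (suc k)
      ≡⟨ binomialTransform-suc f k ⟨
    binomialTransform f (suc k)
      ≡⟨ vanishes (suc k) (s≤s z≤n) sk≤t ⟩
    0ℚ
      ≡⟨ binomialTransform-const (f 0) k ⟨
    binomialTransform (λ _ → f 0) (suc k)
      ≡⟨ binomialTransform-suc (λ _ → f 0) k ⟩
    lower ℚ.+ f 0 ∎)
    where
    lower = sumTo k (λ i → signedBinomial (suc k) i (f 0))

-- The wreath product acting on C_r × [n]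

module _ (r : ℕ) .{{_ : NonZero r}} where

  private
    infixl 6 _+ᶜ_
    _+ᶜ_ : Cyc r → Cyc r → Cyc r
    _+ᶜ_ = _⊕_ r

    %-absorbˡ : ∀ x y → (x % r + y) % r ≡ (x + y) % r
    %-absorbˡ x y = begin
      (x % r + y) % r           ≡⟨ %-distribˡ-+ (x % r) y r ⟩
      (x % r % r + y % r) % r   ≡⟨ cong (λ z → (z + y % r) % r) (m%n%n≡m%n x r) ⟩
      (x % r + y % r) % r       ≡⟨ %-distribˡ-+ x y r ⟨
      (x + y) % r               ∎

    %-absorbʳ : ∀ x y → (x + y % r) % r ≡ (x + y) % r
    %-absorbʳ x y = begin
      (x + y % r) % r ≡⟨ cong (_% r) (ℕP.+-comm x (y % r)) ⟩
      (y % r + x) % r ≡⟨ %-absorbˡ y x ⟩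
      (y + x) % r     ≡⟨ cong (_% r) (ℕP.+-comm y x) ⟩
      (x + y) % r     ∎

    mod-cong : ∀ {x y} → x % r ≡ y % r → x mod r ≡ y mod r
    mod-cong eq = fromℕ<-cong _ _ eq _ _

    toℕ-mod : ∀ x → toℕ (x mod r) ≡ x % r
    toℕ-mod x = toℕ-fromℕ< _

    toℕ-mod-id : ∀ (a : Cyc r) → toℕ a mod r ≡ a
    toℕ-mod-id a = toℕ-injective (trans (toℕ-mod (toℕ a)) (m<n⇒m%n≡m (toℕ<n a)))

    ⊕-assoc : ∀ a b c → a +ᶜ b +ᶜ c ≡ a +ᶜ (b +ᶜ c)
    ⊕-assoc a b c = mod-cong (begin
      (toℕ (a +ᶜ b) + toℕ c) % r          ≡⟨ cong (λ z → (z + toℕ c) % r) (toℕ-mod (toℕ a + toℕ b)) ⟩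
      ((toℕ a + toℕ b) % r + toℕ c) % r   ≡⟨ %-absorbˡ (toℕ a + toℕ b) (toℕ c) ⟩
      (toℕ a + toℕ b + toℕ c) % r         ≡⟨ cong (_% r) (ℕP.+-assoc (toℕ a) (toℕ b) (toℕ c)) ⟩
      (toℕ a + (toℕ b + toℕ c)) % r       ≡⟨ %-absorbʳ (toℕ a) (toℕ b + toℕ c) ⟨
      (toℕ a + (toℕ b + toℕ c) % r) % r   ≡⟨ cong (λ z → (toℕ a + z) % r) (toℕ-mod (toℕ b + toℕ c)) ⟨
      (toℕ a + toℕ (b +ᶜ c)) % r          ∎)

    ⊕-comm : ∀ a b → a +ᶜ b ≡ b +ᶜ a
    ⊕-comm a b = cong (_mod r) (ℕP.+-comm (toℕ a) (toℕ b))

    ⊕-identityʳ : ∀ a → a +ᶜ 0c r ≡ a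
    ⊕-identityʳ a = trans (mod-cong (begin
      (toℕ a + toℕ (0 mod r)) % r ≡⟨ cong (λ z → (toℕ a + z) % r) (toℕ-mod 0) ⟩
      (toℕ a + 0 % r) % r         ≡⟨ %-absorbʳ (toℕ a) 0 ⟩
      (toℕ a + 0) % r             ≡⟨ cong (_% r) (ℕP.+-identityʳ (toℕ a)) ⟩
      toℕ a % r                   ∎)) (toℕ-mod-id a)

    ⊖-inverseʳ : ∀ a → a +ᶜ ⊖_ r a ≡ 0c r
    ⊖-inverseʳ a = mod-cong (begin
      (toℕ a + toℕ ((r ∸ toℕ a) mod r)) % r ≡⟨ cong (λ z → (toℕ a + z) % r) (toℕ-mod (r ∸ toℕ a)) ⟩
      (toℕ a + (r ∸ toℕ a) % r) % r         ≡⟨ %-absorbʳ (toℕ a) (r ∸ toℕ a) ⟩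
      (toℕ a + (r ∸ toℕ a)) % r             ≡⟨ cong (_% r) (ℕP.m+[n∸m]≡n (ℕP.<⇒≤ (toℕ<n a))) ⟩
      r % r                                 ≡⟨ n%n≡0 r ⟩
      0                                     ≡⟨ m<n⇒m%n≡m (>-nonZero⁻¹ r) ⟨
      0 % r                                 ∎)

  Cyc-abelianGroup : AbelianGroup 0ℓ 0ℓ
  Cyc-abelianGroup = record
    { Carrier        = Cyc r
    ; _≈_            = _≡_
    ; _∙_            = _+ᶜ_
    ; ε              = 0c r
    ; _⁻¹            = ⊖_ r
    ; isAbelianGroup = record
      { isGroup = record
        { isMonoid = record
          { isSemigroup = record
            { isMagma = record { isEquivalence = isEquivalence ; ∙-cong = cong₂ _+ᶜ_ }
            ; assoc   = ⊕-assoc }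
          ; identity = (λ a → trans (⊕-comm (0c r) a) (⊕-identityʳ a)) , ⊕-identityʳ }
        ; inverse = (λ a → trans (⊕-comm (⊖_ r a) a) (⊖-inverseʳ a)) , ⊖-inverseʳ
        ; ⁻¹-cong = cong (⊖_ r) }
      ; comm = ⊕-comm } }

module _ {r n : ℕ} .{{_ : NonZero r}} where

  open AbelianGroup (Cyc-abelianGroup r) using (_∙_; ε; identityʳ; commutativeSemigroup)
  open import Algebra.Properties.AbelianGroup (Cyc-abelianGroup r) using (//-rightDividesˡ; //-rightDividesʳ; identityʳ-unique)
  open import Algebra.Properties.CommutativeSemigroup commutativeSemigroup using (x∙yz≈xz∙y)

  act-∙ : ∀ (u v : W r n) p → act (u ·W v) p ≡ act u (act v p)
  act-∙ (f , π) (g , σ) (c , i) = cong (_, π ⟨$⟩ʳ (σ ⟨$⟩ʳ i)) (begin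
    c ∙ (f (π ⟨$⟩ʳ (σ ⟨$⟩ʳ i)) ∙ g (π ⟨$⟩ˡ (π ⟨$⟩ʳ (σ ⟨$⟩ʳ i))))
      ≡⟨ cong (λ j → c ∙ (f (π ⟨$⟩ʳ (σ ⟨$⟩ʳ i)) ∙ g j)) (inverseˡ π) ⟩
    c ∙ (f (π ⟨$⟩ʳ (σ ⟨$⟩ʳ i)) ∙ g (σ ⟨$⟩ʳ i))
      ≡⟨ x∙yz≈xz∙y c (f (π ⟨$⟩ʳ (σ ⟨$⟩ʳ i))) (g (σ ⟨$⟩ʳ i)) ⟩
    c ∙ g (σ ⟨$⟩ʳ i) ∙ f (π ⟨$⟩ʳ (σ ⟨$⟩ʳ i)) ∎)

  act-invW-act : ∀ (x : W r n) p → act (invW x) (act x p) ≡ p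
  act-invW-act (f , π) (c , i) rewrite inverseˡ π {i} = cong (_, i) (//-rightDividesʳ (f (π ⟨$⟩ʳ i)) c)

  act-act-invW : ∀ (x : W r n) p → act x (act (invW x) p) ≡ p
  act-act-invW (f , π) (c , i) rewrite inverseʳ π {i} = cong (_, i) (//-rightDividesˡ (f i) c)

  -- A point (c , i) of C_r × [n] has colour c and lies in the fibre i.
  act-fixes-colourblind : ∀ (g : W r n) {c c′ i} → act g (c , i) ≡ (c , i) → act g (c′ , i) ≡ (c′ , i)
  act-fixes-colourblind (f , π) {c} {c′} {i} fixes = cong₂ _,_ (begin
    c′ ∙ f (π ⟨$⟩ʳ i) ≡⟨ cong (c′ ∙_) (identityʳ-unique c (f (π ⟨$⟩ʳ i)) (cong proj₁ fixes)) ⟩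
    c′ ∙ ε            ≡⟨ identityʳ c′ ⟩
    c′                ∎) (cong proj₂ fixes)

  act-fibre-injective : ∀ (g : W r n) {p q} → proj₂ (act g p) ≡ proj₂ (act g q) → proj₂ p ≡ proj₂ q
  act-fibre-injective (f , π) {c , i} {d , j} eq = begin
    i                 ≡⟨ inverseˡ π ⟨
    π ⟨$⟩ˡ (π ⟨$⟩ʳ i)  ≡⟨ cong (π ⟨$⟩ˡ_) eq ⟩
    π ⟨$⟩ˡ (π ⟨$⟩ʳ j)  ≡⟨ inverseˡ π ⟩
    j                 ∎

-- Tuples in distinct fibres

avoids? : ∀ {n j} (i : Fin n) (fs : Vec (Fin n) j) → Dec (All (i ≢_) fs)
avoids? i = All.all? (λ i′ → ¬? (i ≟ᶠ i′))

𝟙-avoids?-∷ : ∀ {n j} (i x : Fin n) (xs : Vec (Fin n) j) →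
              𝟙 (avoids? i (x ∷ xs)) ≡ 𝟙 (¬? (i ≟ᶠ x)) * 𝟙 (avoids? i xs)
𝟙-avoids?-∷ i x xs =
  𝟙-split (λ { (i≢x ∷ i∉xs) → i≢x , i∉xs }) (uncurry _∷_) (avoids? i (x ∷ xs)) (¬? (i ≟ᶠ x)) (avoids? i xs)

∑-allFin-split : ∀ {n} (x : Fin n) (g : Fin n → ℕ) →
                 ∑[ i ∈ allFin n ] (𝟙 (¬? (i ≟ᶠ x)) * g i) + g x ≡ ∑[ i ∈ allFin n ] g i
∑-allFin-split {n} x g = begin
  ∑[ i ∈ allFin n ] (𝟙 (¬? (i ≟ᶠ x)) * g i) + g x
    ≡⟨ cong (∑[ i ∈ allFin n ] (𝟙 (¬? (i ≟ᶠ x)) * g i) +_) (∑-δ _≟ᶠ_ (allFin⁺ n) (∈-allFin x) g) ⟨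
  ∑[ i ∈ allFin n ] (𝟙 (¬? (i ≟ᶠ x)) * g i) + ∑[ i ∈ allFin n ] (𝟙 (x ≟ᶠ i) * g i)
    ≡⟨ ∑-+ (allFin n) _ _ ⟨
  ∑[ i ∈ allFin n ] (𝟙 (¬? (i ≟ᶠ x)) * g i + 𝟙 (x ≟ᶠ i) * g i)
    ≡⟨ ∑-cong (allFin n) (λ i → trans (sym (ℕP.*-distribʳ-+ (g i) (𝟙 (¬? (i ≟ᶠ x))) (𝟙 (x ≟ᶠ i))))
                                      (trans (cong (_* g i) (once i)) (ℕP.*-identityˡ (g i)))) ⟩
  ∑[ i ∈ allFin n ] g i ∎
  where
  once : ∀ i → 𝟙 (¬? (i ≟ᶠ x)) + 𝟙 (x ≟ᶠ i) ≡ 1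
  once i = trans (cong (𝟙 (¬? (i ≟ᶠ x)) +_) (𝟙-cong sym sym (x ≟ᶠ i) (i ≟ᶠ x))) (𝟙-¬?+𝟙 (i ≟ᶠ x))

∑-avoiding : ∀ {n j} {fs : Vec (Fin n) j} → Uniqueᵥ fs → (f : Fin n → ℕ) → All (λ i → f i ≡ 1) fs →
             ∑[ i ∈ allFin n ] (𝟙 (avoids? i fs) * f i) + j ≡ ∑[ i ∈ allFin n ] f i
∑-avoiding {n} {fs = []} [] f [] = trans (ℕP.+-identityʳ _) (∑-cong (allFin n) (λ i → ℕP.*-identityˡ (f i)))
∑-avoiding {n} {suc j} {x ∷ xs} (x∉xs ∷ unique) f (fx≡1 ∷ fxs≡1) = begin
  ∑[ i ∈ allFin n ] (𝟙 (avoids? i (x ∷ xs)) * f i) + suc j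
    ≡⟨ cong (_+ suc j) (∑-cong (allFin n) (λ i →
         trans (cong (_* f i) (𝟙-avoids?-∷ i x xs)) (ℕP.*-assoc (𝟙 (¬? (i ≟ᶠ x))) (𝟙 (avoids? i xs)) (f i)))) ⟩
  outside-x + suc j
    ≡⟨ cong (λ s → outside-x + (s + j)) gx≡1 ⟨
  outside-x + (g x + j)
    ≡⟨ ℕP.+-assoc outside-x (g x) j ⟨
  outside-x + g x + j
    ≡⟨ cong (_+ j) (∑-allFin-split x g) ⟩
  ∑[ i ∈ allFin n ] g i + j
    ≡⟨ ∑-avoiding unique f fxs≡1 ⟩
  ∑[ i ∈ allFin n ] f i ∎
  where
  g : Fin n → ℕ
  g i = 𝟙 (avoids? i xs) * f i
  outside-x = ∑[ i ∈ allFin n ] (𝟙 (¬? (i ≟ᶠ x)) * g i)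
  gx≡1 : g x ≡ 1
  gx≡1 = cong₂ _*_ (𝟙-yes x∉xs (avoids? x xs)) fx≡1

module _ {r n : ℕ} .{{_ : NonZero r}} where

  Point : Set
  Point = Cyc r × Fin n

  infix 4 _≟ₚ_
  _≟ₚ_ : DecidableEquality Point
  _≟ₚ_ = ≡-dec _≟ᶠ_ _≟ᶠ_

  points≡cartesianProduct : points ≡ cartesianProduct (allFin r) (allFin n)
  points≡cartesianProduct = concatMap-map≡cartesianProductWith _,_ (allFin r) (allFin n)

  ∈-points : ∀ p → p ∈ points
  ∈-points (c , i) = subst ((c , i) ∈_) (sym points≡cartesianProduct) (∈-cartesianProduct⁺ (∈-allFin c) (∈-allFin i))

  points-unique : Unique points
  points-unique = subst Unique (sym points≡cartesianProduct) (cartesianProduct⁺ (allFin⁺ r) (allFin⁺ n))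

  ∑-points-δ : ∀ q (h : Point → ℕ) → ∑[ p ∈ points ] (𝟙 (q ≟ₚ p) * h p) ≡ h q
  ∑-points-δ q = ∑-δ _≟ₚ_ points-unique (∈-points q)

  ∑-points-colourblind : (h : Point → ℕ) → (∀ c c′ i → h (c , i) ≡ h (c′ , i)) →
                         ∑[ p ∈ points ] h p ≡ r * ∑[ i ∈ allFin n ] h (0c r , i)
  ∑-points-colourblind h colourblind = begin
    ∑[ p ∈ points ] h p
      ≡⟨ cong (λ ps → ∑ ps h) points≡cartesianProduct ⟩
    ∑[ p ∈ cartesianProduct (allFin r) (allFin n) ] h p
      ≡⟨ ∑-cartesianProductWith _,_ (allFin r) (allFin n) h ⟩
    ∑[ c ∈ allFin r ] ∑[ i ∈ allFin n ] h (c , i)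
      ≡⟨ ∑-cong (allFin r) (λ c → ∑-cong (allFin n) (colourblind c (0c r))) ⟩
    ∑[ c ∈ allFin r ] ∑[ i ∈ allFin n ] h (0c r , i)
      ≡⟨ ∑-const (allFin r) _ ⟩
    length (allFin r) * ∑[ i ∈ allFin n ] h (0c r , i)
      ≡⟨ cong (_* ∑[ i ∈ allFin n ] h (0c r , i)) (ListP.length-tabulate {n = r} (λ c → c)) ⟩
    r * ∑[ i ∈ allFin n ] h (0c r , i) ∎

  Tuple : ℕ → Set
  Tuple j = Vec Point j

  infix 4 _≟ₜ_
  _≟ₜ_ : ∀ {j} → DecidableEquality (Tuple j)
  _≟ₜ_ = ≡-decᵥ _≟ₚ_

  fibres : ∀ {j} → Tuple j → Vec (Fin n) j
  fibres = Vec.map proj₂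

  Distinct : ∀ {j} → Tuple j → Set
  Distinct ω = Uniqueᵥ (fibres ω)

  distinct? : ∀ {j} (ω : Tuple j) → Dec (Distinct ω)
  distinct? ω = allPairs? (λ i i′ → ¬? (i ≟ᶠ i′)) (fibres ω)

  Fresh : ∀ {j} → Point → Tuple j → Set
  Fresh p ω = All (proj₂ p ≢_) (fibres ω)

  fresh? : ∀ {j} (p : Point) (ω : Tuple j) → Dec (Fresh p ω)
  fresh? p ω = avoids? (proj₂ p) (fibres ω)

  𝟙-distinct?-∷ : ∀ {j} p (ω : Tuple j) → 𝟙 (distinct? (p ∷ ω)) ≡ 𝟙 (fresh? p ω) * 𝟙 (distinct? ω)
  𝟙-distinct?-∷ p ω =
    𝟙-split (λ { (fresh ∷ distinct) → fresh , distinct }) (uncurry _∷_) (distinct? (p ∷ ω)) (fresh? p ω) (distinct? ω)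

  𝟙-≟ₜ-∷ : ∀ {j} p q (ω ω′ : Tuple j) → 𝟙 (p ∷ ω ≟ₜ q ∷ ω′) ≡ 𝟙 (p ≟ₚ q) * 𝟙 (ω ≟ₜ ω′)
  𝟙-≟ₜ-∷ p q ω ω′ = 𝟙-split ∷-injective (uncurry (cong₂ _∷_)) (p ∷ ω ≟ₜ q ∷ ω′) (p ≟ₚ q) (ω ≟ₜ ω′)

  injective⇒distinct : ∀ {j} {xs : Fin j → Point} → Injective _≡_ _≡_ (λ l → proj₂ (xs l)) → Distinct (tabulate xs)
  injective⇒distinct {xs = xs} injective = subst Uniqueᵥ (tabulate-∘ proj₂ xs) (tabulate⁺ injective)

  distinct⇒injective : ∀ {j} {ω : Tuple j} → Distinct ω → Injective _≡_ _≡_ (λ l → proj₂ (lookup ω l))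
  distinct⇒injective {ω = ω} distinct {l} {l′} eq =
    lookup-injective distinct l l′ (trans (lookup-map l proj₂ ω) (trans eq (sym (lookup-map l′ proj₂ ω))))

  canonicalTuple : ∀ {j} → j ≤ n → Σ (Tuple j) Distinct
  canonicalTuple j≤n = _ , injective⇒distinct {xs = λ l → 0c r , inject≤ l j≤n} (inject≤-injective j≤n j≤n _ _)

  freshFibres : ∀ {j} {ω : Tuple j} → Distinct ω → ∑[ i ∈ allFin n ] 𝟙 (avoids? i (fibres ω)) + j ≡ n
  freshFibres {j} {ω} distinct = begin
    ∑[ i ∈ allFin n ] 𝟙 (avoids? i (fibres ω)) + j
      ≡⟨ cong (_+ j) (∑-cong (allFin n) (λ i → ℕP.*-identityʳ _)) ⟨
    ∑[ i ∈ allFin n ] (𝟙 (avoids? i (fibres ω)) * 1) + j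
      ≡⟨ ∑-avoiding distinct (λ _ → 1) (All.universal (λ _ → refl) _) ⟩
    ∑[ i ∈ allFin n ] 1
      ≡⟨ ∑-1 (allFin n) ⟩
    length (allFin n)
      ≡⟨ ListP.length-tabulate {n = n} (λ i → i) ⟩
    n ∎

  freshPoints : ∀ {j} {ω : Tuple j} → Distinct ω → ∑[ p ∈ points ] 𝟙 (fresh? p ω) ≡ r * (n ∸ j)
  freshPoints {j} {ω} distinct = begin
    ∑[ p ∈ points ] 𝟙 (fresh? p ω)
      ≡⟨ ∑-points-colourblind (λ p → 𝟙 (fresh? p ω)) (λ _ _ _ → refl) ⟩
    r * ∑[ i ∈ allFin n ] 𝟙 (avoids? i (fibres ω))
      ≡⟨ cong (r *_) (trans (sym (ℕP.m+n∸n≡m _ j)) (cong (_∸ j) (freshFibres distinct))) ⟩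
    r * (n ∸ j) ∎

  ∃-fresh : ∀ {j} {ω : Tuple j} → Distinct ω → j < n → ∃[ p ] Fresh p ω
  ∃-fresh {j} {ω} distinct j<n
    with ∑-pos (allFin n) _ (ℕP.+-cancelʳ-< j 0 _ (subst (j <_) (sym (freshFibres distinct)) j<n))
  ... | i , fresh = (0c r , i) , 𝟙>0⇒ (avoids? i (fibres ω)) fresh

  tuples : ∀ j → List (Tuple j)
  tuples zero    = [] ∷ []
  tuples (suc j) = cartesianProductWith _∷_ points (tuples j)

  ∈-tuples : ∀ {j} (ω : Tuple j) → ω ∈ tuples j
  ∈-tuples []      = here refl
  ∈-tuples (p ∷ ω) = ∈-cartesianProductWith⁺ _∷_ (∈-points p) (∈-tuples ω)

  tuples-unique : ∀ j → Unique (tuples j)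
  tuples-unique zero    = ListAll.[] ∷ []
  tuples-unique (suc j) = cartesianProductWith⁺ _∷_ ∷-injective points-unique (tuples-unique j)

  distinctTuples : ∀ j → List (Tuple j)
  distinctTuples j = filter distinct? (tuples j)

  ∈-distinctTuples⁺ : ∀ {j} {ω : Tuple j} → Distinct ω → ω ∈ distinctTuples j
  ∈-distinctTuples⁺ {ω = ω} distinct = ∈-filter⁺ distinct? (∈-tuples ω) distinct

  ∈-distinctTuples⁻ : ∀ {j} {ω : Tuple j} → ω ∈ distinctTuples j → Distinct ω
  ∈-distinctTuples⁻ {j} ω∈ = proj₂ (∈-filter⁻ distinct? {xs = tuples j} ω∈)

  ∑-distinctTuples-δ : ∀ {j} {v : Tuple j} → Distinct v → (h : Tuple j → ℕ) →
                       ∑[ ω ∈ distinctTuples j ] (𝟙 (v ≟ₜ ω) * h ω) ≡ h v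
  ∑-distinctTuples-δ {j} distinct = ∑-δ _≟ₜ_ (filter⁺ distinct? (tuples-unique j)) (∈-distinctTuples⁺ distinct)

  ∑-distinctTuples-suc : ∀ j (h : Tuple (suc j) → ℕ) →
    ∑[ ω ∈ distinctTuples (suc j) ] h ω ≡ ∑[ p ∈ points ] ∑[ ω ∈ distinctTuples j ] (𝟙 (fresh? p ω) * h (p ∷ ω))
  ∑-distinctTuples-suc j h = begin
    ∑[ ω ∈ distinctTuples (suc j) ] h ω
      ≡⟨ ∑-filter distinct? (tuples (suc j)) h ⟩
    ∑[ ω ∈ tuples (suc j) ] (𝟙 (distinct? ω) * h ω)
      ≡⟨ ∑-cartesianProductWith _∷_ points (tuples j) _ ⟩
    ∑[ p ∈ points ] ∑[ ω ∈ tuples j ] (𝟙 (distinct? (p ∷ ω)) * h (p ∷ ω))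
      ≡⟨ ∑-cong points (λ p → ∑-cong (tuples j) (λ ω → split p ω)) ⟩
    ∑[ p ∈ points ] ∑[ ω ∈ tuples j ] (𝟙 (distinct? ω) * (𝟙 (fresh? p ω) * h (p ∷ ω)))
      ≡⟨ ∑-cong points (λ p → ∑-filter distinct? (tuples j) _) ⟨
    ∑[ p ∈ points ] ∑[ ω ∈ distinctTuples j ] (𝟙 (fresh? p ω) * h (p ∷ ω)) ∎
    where
    split : ∀ p ω → 𝟙 (distinct? (p ∷ ω)) * h (p ∷ ω) ≡ 𝟙 (distinct? ω) * (𝟙 (fresh? p ω) * h (p ∷ ω))
    split p ω = trans (cong (_* h (p ∷ ω)) (𝟙-distinct?-∷ p ω)) (swap (𝟙 (fresh? p ω)) (𝟙 (distinct? ω)) (h (p ∷ ω)))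
      where swap : ∀ a b c → a * b * c ≡ b * (a * c)
            swap = solve-∀

  infixr 5 _⋆_
  _⋆_ : ∀ {j} → W r n → Tuple j → Tuple j
  g ⋆ ω = Vec.map (act g) ω

  ⋆-∙ : ∀ {j} u v (ω : Tuple j) → (u ·W v) ⋆ ω ≡ u ⋆ v ⋆ ω
  ⋆-∙ u v ω = trans (map-cong (act-∙ u v) ω) (map-∘ (act u) (act v) ω)

  invW-⋆-⋆ : ∀ {j} x (ω : Tuple j) → invW x ⋆ x ⋆ ω ≡ ω
  invW-⋆-⋆ x ω = trans (sym (map-∘ (act (invW x)) (act x) ω)) (trans (map-cong (act-invW-act x) ω) (map-id ω))

  ⋆-invW-⋆ : ∀ {j} x (ω : Tuple j) → x ⋆ invW x ⋆ ω ≡ ω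
  ⋆-invW-⋆ x ω = trans (sym (map-∘ (act x) (act (invW x)) ω)) (trans (map-cong (act-act-invW x) ω) (map-id ω))

  quotient-fixes⇒ : ∀ {j} x y (ω : Tuple j) → (invW x ·W y) ⋆ ω ≡ ω → y ⋆ ω ≡ x ⋆ ω
  quotient-fixes⇒ x y ω fixes = begin
    y ⋆ ω                  ≡⟨ ⋆-invW-⋆ x (y ⋆ ω) ⟨
    x ⋆ invW x ⋆ y ⋆ ω     ≡⟨ cong (x ⋆_) (⋆-∙ (invW x) y ω) ⟨
    x ⋆ (invW x ·W y) ⋆ ω  ≡⟨ cong (x ⋆_) fixes ⟩
    x ⋆ ω                  ∎

  quotient-fixes⇐ : ∀ {j} x y (ω : Tuple j) → y ⋆ ω ≡ x ⋆ ω → (invW x ·W y) ⋆ ω ≡ ω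
  quotient-fixes⇐ x y ω y⋆ω≡x⋆ω = begin
    (invW x ·W y) ⋆ ω  ≡⟨ ⋆-∙ (invW x) y ω ⟩
    invW x ⋆ y ⋆ ω     ≡⟨ cong (invW x ⋆_) y⋆ω≡x⋆ω ⟩
    invW x ⋆ x ⋆ ω     ≡⟨ invW-⋆-⋆ x ω ⟩
    ω                  ∎

  fresh-⋆ : ∀ {j} g {p} {ω : Tuple j} → Fresh p ω → Fresh (act g p) (g ⋆ ω)
  fresh-⋆ g {ω = []}    []            = []
  fresh-⋆ g {p} {q ∷ _} (p≢q ∷ fresh) = (λ eq → p≢q (act-fibre-injective g {p} {q} eq)) ∷ fresh-⋆ g {p} fresh

  distinct-⋆ : ∀ {j} g {ω : Tuple j} → Distinct ω → Distinct (g ⋆ ω)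
  distinct-⋆ g {[]}    []                 = []
  distinct-⋆ g {q ∷ _} (fresh ∷ distinct) = fresh-⋆ g {q} fresh ∷ distinct-⋆ g distinct

  fixedFibre : W r n → Fin n → ℕ
  fixedFibre g i = 𝟙 (act g (0c r , i) ≟ₚ (0c r , i))

  fixedFibres : W r n → ℕ
  fixedFibres g = ∑[ i ∈ allFin n ] fixedFibre g i

  fixed⇒fibres-fixed : ∀ {j} g {ω : Tuple j} → g ⋆ ω ≡ ω → All (λ i → fixedFibre g i ≡ 1) (fibres ω)
  fixed⇒fibres-fixed g {[]}          _     = []
  fixed⇒fibres-fixed g {(c , i) ∷ ω} fixes =
    𝟙-yes (act-fixes-colourblind g (proj₁ (∷-injective fixes))) _ ∷ fixed⇒fibres-fixed g (proj₂ (∷-injective fixes))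

  fixedTuples : ℕ → W r n → ℕ
  fixedTuples j g = ∑[ ω ∈ distinctTuples j ] 𝟙 (g ⋆ ω ≟ₜ ω)

  fixedFreshPoints : ∀ {j} g {ω : Tuple j} → Distinct ω →
    𝟙 (g ⋆ ω ≟ₜ ω) * ∑[ p ∈ points ] (𝟙 (fresh? p ω) * 𝟙 (act g p ≟ₚ p))
      ≡ 𝟙 (g ⋆ ω ≟ₜ ω) * (r * (fixedFibres g ∸ j))
  fixedFreshPoints {j} g {ω} distinct = 𝟙-*-cong (g ⋆ ω ≟ₜ ω) λ fixes → begin
    ∑[ p ∈ points ] (𝟙 (fresh? p ω) * 𝟙 (act g p ≟ₚ p))
      ≡⟨ ∑-points-colourblind _ (λ c c′ i → cong (𝟙 (avoids? i (fibres ω)) *_)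
           (𝟙-cong (act-fixes-colourblind g) (act-fixes-colourblind g) (act g (c , i) ≟ₚ (c , i)) (act g (c′ , i) ≟ₚ (c′ , i)))) ⟩
    r * ∑[ i ∈ allFin n ] (𝟙 (avoids? i (fibres ω)) * fixedFibre g i)
      ≡⟨ cong (r *_) (trans (sym (ℕP.m+n∸n≡m _ j))
           (cong (_∸ j) (∑-avoiding distinct (fixedFibre g) (fixed⇒fibres-fixed g fixes)))) ⟩
    r * (fixedFibres g ∸ j) ∎

  -- A fixed (j + 1)-tuple p ∷ ω consists of a fixed j-tuple ω and a fixed point p in a fibre
  -- not used by ω; there are r (fixedFibres g ∸ j) such points.
  fixedTuples-suc : ∀ j g → fixedTuples (suc j) g ≡ fixedTuples j g * (r * (fixedFibres g ∸ j))
  fixedTuples-suc j g = begin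
    fixedTuples (suc j) g
      ≡⟨ ∑-distinctTuples-suc j (λ ω → 𝟙 (g ⋆ ω ≟ₜ ω)) ⟩
    ∑[ p ∈ points ] ∑[ ω ∈ D ] (𝟙 (fresh? p ω) * 𝟙 (g ⋆ (p ∷ ω) ≟ₜ p ∷ ω))
      ≡⟨ ∑-cong points (λ p → ∑-cong D (λ ω → split p ω)) ⟩
    ∑[ p ∈ points ] ∑[ ω ∈ D ] (𝟙 (g ⋆ ω ≟ₜ ω) * (𝟙 (fresh? p ω) * 𝟙 (act g p ≟ₚ p)))
      ≡⟨ ∑-comm points D _ ⟩
    ∑[ ω ∈ D ] ∑[ p ∈ points ] (𝟙 (g ⋆ ω ≟ₜ ω) * (𝟙 (fresh? p ω) * 𝟙 (act g p ≟ₚ p)))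
      ≡⟨ ∑-cong D (λ ω → ∑-*ˡ points (𝟙 (g ⋆ ω ≟ₜ ω)) _) ⟩
    ∑[ ω ∈ D ] (𝟙 (g ⋆ ω ≟ₜ ω) * ∑[ p ∈ points ] (𝟙 (fresh? p ω) * 𝟙 (act g p ≟ₚ p)))
      ≡⟨ ∑-cong-∈ D (λ ω∈ → fixedFreshPoints g (∈-distinctTuples⁻ ω∈)) ⟩
    ∑[ ω ∈ D ] (𝟙 (g ⋆ ω ≟ₜ ω) * (r * (fixedFibres g ∸ j)))
      ≡⟨ ∑-*ʳ D _ _ ⟩
    fixedTuples j g * (r * (fixedFibres g ∸ j)) ∎
    where
    D = distinctTuples j
    split : ∀ p ω → 𝟙 (fresh? p ω) * 𝟙 (g ⋆ (p ∷ ω) ≟ₜ p ∷ ω)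
                  ≡ 𝟙 (g ⋆ ω ≟ₜ ω) * (𝟙 (fresh? p ω) * 𝟙 (act g p ≟ₚ p))
    split p ω = trans (cong (𝟙 (fresh? p ω) *_) (𝟙-≟ₜ-∷ (act g p) p (g ⋆ ω) ω))
                      (rotate (𝟙 (fresh? p ω)) (𝟙 (act g p ≟ₚ p)) (𝟙 (g ⋆ ω ≟ₜ ω)))
      where rotate : ∀ a b c → a * (b * c) ≡ c * (a * b)
            rotate = solve-∀

  fixedTuples≡ : ∀ j g → fixedTuples j g ≡ r ^ j * (fixedFibres g P′ j)
  fixedTuples≡ zero    g = refl
  fixedTuples≡ (suc j) g = begin
    fixedTuples (suc j) g                ≡⟨ fixedTuples-suc j g ⟩
    fixedTuples j g * (r * (m ∸ j))      ≡⟨ cong (_* (r * (m ∸ j))) (fixedTuples≡ j g) ⟩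
    r ^ j * (m P′ j) * (r * (m ∸ j))     ≡⟨ rearrange (r ^ j) (m P′ j) r (m ∸ j) ⟩
    r * r ^ j * ((m ∸ j) * (m P′ j))     ∎
    where
    m = fixedFibres g
    rearrange : ∀ a b c d → a * b * (c * d) ≡ c * a * (d * b)
    rearrange = solve-∀

-- Transport numbers and designs

module _ {r n : ℕ} .{{_ : NonZero r}} (Y : List (W r n)) where

  transports : ∀ {j} → Tuple j → Tuple j → ℕ
  transports ω ω′ = ∑[ y ∈ Y ] 𝟙 (y ⋆ ω ≟ₜ ω′)

  ConstantTransport : ℕ → ℕ → Set
  ConstantTransport j c = ∀ {ω ω′ : Tuple j} → Distinct ω → Distinct ω′ → transports ω ω′ ≡ c

  quotients : List (W r n)
  quotients = cartesianProductWith (λ x y → invW x ·W y) Y Y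

  squareSum : ℕ → ℕ
  squareSum j = ∑[ ω ∈ distinctTuples j ] ∑[ ω′ ∈ distinctTuples j ] (transports ω ω′ * transports ω ω′)

  transportCount≡transports : ∀ {t} (xs ys : Fin t → Point) → transportCount Y xs ys ≡ transports (tabulate xs) (tabulate ys)
  transportCount≡transports xs ys = trans (length-filter _ Y) (∑-cong Y (λ y → 𝟙-cong (to y) (from y) _ _))
    where
    to : ∀ y → (∀ l → act y (xs l) ≡ ys l) → y ⋆ tabulate xs ≡ tabulate ys
    to y maps = trans (sym (tabulate-∘ (act y) xs)) (tabulate-cong maps)
    from : ∀ y → y ⋆ tabulate xs ≡ tabulate ys → ∀ l → act y (xs l) ≡ ys l
    from y maps l = begin
      act y (xs l)                              ≡⟨ lookup∘tabulate (λ l → act y (xs l)) l ⟨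
      lookup (tabulate (λ l → act y (xs l))) l  ≡⟨ cong (λ ω → lookup ω l) (trans (tabulate-∘ (act y) xs) maps) ⟩
      lookup (tabulate ys) l                    ≡⟨ lookup∘tabulate ys l ⟩
      ys l                                      ∎

  isDesign⇒constantTransport : ∀ {t} → IsDesign t Y → ∃[ c ] ConstantTransport t c
  isDesign⇒constantTransport (c , _ , count≡c) = c , λ {ω} {ω′} distinct distinct′ → begin
    transports ω ω′
      ≡⟨ cong₂ transports (tabulate∘lookup ω) (tabulate∘lookup ω′) ⟨
    transports (tabulate (lookup ω)) (tabulate (lookup ω′))
      ≡⟨ transportCount≡transports (lookup ω) (lookup ω′) ⟨
    transportCount Y (lookup ω) (lookup ω′)
      ≡⟨ count≡c (lookup ω) (lookup ω′) (distinct⇒injective distinct) (distinct⇒injective distinct′) ⟩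
    c ∎

  constantTransport⇒isDesign : ∀ {t c} → 0 < c → ConstantTransport t c → IsDesign t Y
  constantTransport⇒isDesign {c = c} c>0 constant = c , c>0 , λ xs ys injective injective′ →
    trans (transportCount≡transports xs ys) (constant (injective⇒distinct injective) (injective⇒distinct injective′))

  ∑-transports : ∀ {j} {ω : Tuple j} → Distinct ω → ∑[ ω′ ∈ distinctTuples j ] transports ω ω′ ≡ length Y
  ∑-transports {j} {ω} distinct = begin
    ∑[ ω′ ∈ D ] ∑[ y ∈ Y ] 𝟙 (y ⋆ ω ≟ₜ ω′)
      ≡⟨ ∑-comm D Y _ ⟩
    ∑[ y ∈ Y ] ∑[ ω′ ∈ D ] 𝟙 (y ⋆ ω ≟ₜ ω′)
      ≡⟨ ∑-cong Y (λ y → ∑-cong D (λ ω′ → ℕP.*-identityʳ _)) ⟨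
    ∑[ y ∈ Y ] ∑[ ω′ ∈ D ] (𝟙 (y ⋆ ω ≟ₜ ω′) * 1)
      ≡⟨ ∑-cong Y (λ y → ∑-distinctTuples-δ (distinct-⋆ y distinct) (λ _ → 1)) ⟩
    ∑[ y ∈ Y ] 1
      ≡⟨ ∑-1 Y ⟩
    length Y ∎
    where D = distinctTuples j

  -- x⁻¹y fixes ω iff x and y send ω to the same tuple ω′.
  ∑-fixedTuples-quotients : ∀ j → ∑[ g ∈ quotients ] fixedTuples j g ≡ squareSum j
  ∑-fixedTuples-quotients j = begin
    ∑[ g ∈ quotients ] fixedTuples j g
      ≡⟨ ∑-cartesianProductWith _ Y Y (fixedTuples j) ⟩
    ∑[ x ∈ Y ] ∑[ y ∈ Y ] ∑[ ω ∈ D ] 𝟙 ((invW x ·W y) ⋆ ω ≟ₜ ω)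
      ≡⟨ ∑-cong Y (λ x → ∑-cong Y (λ y → ∑-cong-∈ D (λ ω∈ → meet x y (∈-distinctTuples⁻ ω∈)))) ⟩
    ∑[ x ∈ Y ] ∑[ y ∈ Y ] ∑[ ω ∈ D ] ∑[ ω′ ∈ D ] (𝟙 (x ⋆ ω ≟ₜ ω′) * 𝟙 (y ⋆ ω ≟ₜ ω′))
      ≡⟨ ∑²-comm Y D _ ⟩
    ∑[ ω ∈ D ] ∑[ x ∈ Y ] ∑[ y ∈ Y ] ∑[ ω′ ∈ D ] (𝟙 (x ⋆ ω ≟ₜ ω′) * 𝟙 (y ⋆ ω ≟ₜ ω′))
      ≡⟨ ∑-cong D (λ ω → ∑²-comm Y D _) ⟩
    ∑[ ω ∈ D ] ∑[ ω′ ∈ D ] ∑[ x ∈ Y ] ∑[ y ∈ Y ] (𝟙 (x ⋆ ω ≟ₜ ω′) * 𝟙 (y ⋆ ω ≟ₜ ω′))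
      ≡⟨ ∑-cong D (λ ω → ∑-cong D (λ ω′ → ∑-*-∑ Y Y _ _)) ⟨
    squareSum j ∎
    where
    D = distinctTuples j
    meet : ∀ x y {ω} → Distinct ω →
           𝟙 ((invW x ·W y) ⋆ ω ≟ₜ ω) ≡ ∑[ ω′ ∈ D ] (𝟙 (x ⋆ ω ≟ₜ ω′) * 𝟙 (y ⋆ ω ≟ₜ ω′))
    meet x y {ω} distinct = begin
      𝟙 ((invW x ·W y) ⋆ ω ≟ₜ ω)
        ≡⟨ 𝟙-cong (quotient-fixes⇒ x y ω) (quotient-fixes⇐ x y ω) _ _ ⟩
      𝟙 (y ⋆ ω ≟ₜ x ⋆ ω)
        ≡⟨ ∑-distinctTuples-δ (distinct-⋆ x distinct) (λ ω′ → 𝟙 (y ⋆ ω ≟ₜ ω′)) ⟨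
      ∑[ ω′ ∈ D ] (𝟙 (x ⋆ ω ≟ₜ ω′) * 𝟙 (y ⋆ ω ≟ₜ ω′)) ∎

  -- Fix a point p₀ in a fibre not used by ω: each y with y ⋆ ω ≡ ω′ sends p₀ ∷ ω to p ∷ ω′ for
  -- exactly one p in a fibre not used by ω′.
  constantTransport-pred : ∀ {j c} → suc j ≤ n → ConstantTransport (suc j) c → ConstantTransport j (r * (n ∸ j) * c)
  constantTransport-pred {j} {c} sj≤n constant {ω} {ω′} distinct distinct′ with ∃-fresh distinct sj≤n
  ... | p₀ , fresh₀ = begin
    transports ω ω′
      ≡⟨ ∑-cong Y (λ y → sym (trans (∑-points-δ (act y p₀) _) (extend y))) ⟩
    ∑[ y ∈ Y ] ∑[ p ∈ points ] (𝟙 (act y p₀ ≟ₚ p) * (𝟙 (fresh? p ω′) * 𝟙 (y ⋆ ω ≟ₜ ω′)))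
      ≡⟨ ∑-comm Y points _ ⟩
    ∑[ p ∈ points ] ∑[ y ∈ Y ] (𝟙 (act y p₀ ≟ₚ p) * (𝟙 (fresh? p ω′) * 𝟙 (y ⋆ ω ≟ₜ ω′)))
      ≡⟨ ∑-cong points (λ p → trans (∑-cong Y (λ y → swap (𝟙 (act y p₀ ≟ₚ p)) (𝟙 (fresh? p ω′)) _))
                                    (∑-*ˡ Y (𝟙 (fresh? p ω′)) (λ y → 𝟙 (act y p₀ ≟ₚ p) * 𝟙 (y ⋆ ω ≟ₜ ω′)))) ⟩
    ∑[ p ∈ points ] (𝟙 (fresh? p ω′) * ∑[ y ∈ Y ] (𝟙 (act y p₀ ≟ₚ p) * 𝟙 (y ⋆ ω ≟ₜ ω′)))
      ≡⟨ ∑-cong points (λ p → cong (𝟙 (fresh? p ω′) *_) (∑-cong Y (λ y → 𝟙-≟ₜ-∷ (act y p₀) p (y ⋆ ω) ω′))) ⟨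
    ∑[ p ∈ points ] (𝟙 (fresh? p ω′) * transports (p₀ ∷ ω) (p ∷ ω′))
      ≡⟨ ∑-cong points (λ p → 𝟙-*-cong (fresh? p ω′) (λ fresh → constant (fresh₀ ∷ distinct) (fresh ∷ distinct′))) ⟩
    ∑[ p ∈ points ] (𝟙 (fresh? p ω′) * c)
      ≡⟨ ∑-*ʳ points c _ ⟩
    ∑[ p ∈ points ] 𝟙 (fresh? p ω′) * c
      ≡⟨ cong (_* c) (freshPoints distinct′) ⟩
    r * (n ∸ j) * c ∎
    where
    extend : ∀ y → 𝟙 (fresh? (act y p₀) ω′) * 𝟙 (y ⋆ ω ≟ₜ ω′) ≡ 𝟙 (y ⋆ ω ≟ₜ ω′)
    extend y = begin
      𝟙 (fresh? (act y p₀) ω′) * 𝟙 (y ⋆ ω ≟ₜ ω′)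
        ≡⟨ ℕP.*-comm (𝟙 (fresh? (act y p₀) ω′)) (𝟙 (y ⋆ ω ≟ₜ ω′)) ⟩
      𝟙 (y ⋆ ω ≟ₜ ω′) * 𝟙 (fresh? (act y p₀) ω′)
        ≡⟨ 𝟙-*-cong (y ⋆ ω ≟ₜ ω′) (λ y⋆ω≡ω′ →
             𝟙-yes (subst (Fresh (act y p₀)) y⋆ω≡ω′ (fresh-⋆ y {p₀} fresh₀)) _) ⟩
      𝟙 (y ⋆ ω ≟ₜ ω′) * 1
        ≡⟨ ℕP.*-identityʳ (𝟙 (y ⋆ ω ≟ₜ ω′)) ⟩
      𝟙 (y ⋆ ω ≟ₜ ω′) ∎
    swap : ∀ a b c → a * (b * c) ≡ b * (a * c)
    swap = solve-∀

  constantTransport-downward : ∀ {t c} → t ≤ n → ConstantTransport t c →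
                               ∀ {j} → j ≤ t → ∃[ c′ ] ConstantTransport j c′
  constantTransport-downward {zero}  {c} _   constant z≤n = c , constant
  constantTransport-downward {suc t} {c} t≤n constant j≤t with ℕP.m≤n⇒m<n∨m≡n j≤t
  ... | inj₂ refl        = c , constant
  ... | inj₁ (s≤s j≤t-1) =
    constantTransport-downward (ℕP.≤-trans (ℕP.n≤1+n t) t≤n) (constantTransport-pred t≤n constant) j≤t-1

  length-distinctTuples*constant : ∀ {j c} → j ≤ n → ConstantTransport j c → length (distinctTuples j) * c ≡ length Y
  length-distinctTuples*constant {j} {c} j≤n constant with canonicalTuple j≤n
  ... | ω₀ , distinct₀ = begin
    length D * c                  ≡⟨ ∑-const D c ⟨
    ∑[ ω′ ∈ D ] c                 ≡⟨ ∑-cong-∈ D (λ ω′∈ → sym (constant distinct₀ (∈-distinctTuples⁻ ω′∈))) ⟩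
    ∑[ ω′ ∈ D ] transports ω₀ ω′  ≡⟨ ∑-transports distinct₀ ⟩
    length Y                      ∎
    where D = distinctTuples j

  constantTransport⇒squareSum : ∀ {j c} → j ≤ n → ConstantTransport j c → squareSum j ≡ length Y * length Y
  constantTransport⇒squareSum {j} {c} j≤n constant = begin
    squareSum j
      ≡⟨ ∑-cong-∈ D (λ ω∈ → ∑-cong-∈ D (λ ω′∈ →
           cong (_* _) (constant (∈-distinctTuples⁻ ω∈) (∈-distinctTuples⁻ ω′∈)))) ⟩
    ∑[ ω ∈ D ] ∑[ ω′ ∈ D ] (c * transports ω ω′)
      ≡⟨ ∑-cong-∈ D (λ ω∈ → trans (∑-*ˡ D c _) (cong (c *_) (∑-transports (∈-distinctTuples⁻ ω∈)))) ⟩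
    ∑[ ω ∈ D ] (c * length Y)
      ≡⟨ ∑-const D _ ⟩
    length D * (c * length Y)
      ≡⟨ ℕP.*-assoc (length D) c _ ⟨
    length D * c * length Y
      ≡⟨ cong (_* length Y) (length-distinctTuples*constant j≤n constant) ⟩
    length Y * length Y ∎
    where D = distinctTuples j

  -- Cauchy–Schwarz over the M² pairs of tuples, on which the transport numbers sum to M L and
  -- their squares to L².
  squareSum⇒constantTransport : ∀ {j} → j ≤ n → 0 < length Y → squareSum j ≡ length Y * length Y →
                                ∃[ c ] (0 < c × ConstantTransport j c)
  squareSum⇒constantTransport {j} j≤n L>0 squareSum≡L² with canonicalTuple j≤n
  ... | ω₀ , distinct₀ = transports ω₀ ω₀ , c>0 , constant
    where
    D = distinctTuples j
    pairs = cartesianProduct D D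
    M = length D
    L = length Y
    a : Tuple j × Tuple j → ℕ
    a (ω , ω′) = transports ω ω′
    ∑-pairs : ∀ f → ∑[ u ∈ pairs ] f u ≡ ∑[ ω ∈ D ] ∑[ ω′ ∈ D ] f (ω , ω′)
    ∑-pairs = ∑-cartesianProductWith _,_ D D
    length-pairs : length pairs ≡ M * M
    length-pairs = begin
      length pairs              ≡⟨ ∑-1 pairs ⟨
      ∑[ u ∈ pairs ] 1          ≡⟨ ∑-pairs (λ _ → 1) ⟩
      ∑[ ω ∈ D ] ∑[ ω′ ∈ D ] 1  ≡⟨ ∑-cong D (λ _ → ∑-1 D) ⟩
      ∑[ ω ∈ D ] M              ≡⟨ ∑-const D M ⟩
      M * M                     ∎
    ∑a : ∑ pairs a ≡ M * L
    ∑a = begin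
      ∑ pairs a                              ≡⟨ ∑-pairs a ⟩
      ∑[ ω ∈ D ] ∑[ ω′ ∈ D ] transports ω ω′ ≡⟨ ∑-cong-∈ D (λ ω∈ → ∑-transports (∈-distinctTuples⁻ ω∈)) ⟩
      ∑[ ω ∈ D ] L                           ≡⟨ ∑-const D L ⟩
      M * L                                  ∎
    tight : length pairs * ∑[ u ∈ pairs ] (a u * a u) ≡ ∑ pairs a * ∑ pairs a
    tight = begin
      length pairs * ∑[ u ∈ pairs ] (a u * a u) ≡⟨ cong₂ _*_ length-pairs (trans (∑-pairs (λ u → a u * a u)) squareSum≡L²) ⟩
      M * M * (L * L)                           ≡⟨ interchange M M L L ⟩
      M * L * (M * L)                           ≡⟨ cong₂ _*_ ∑a ∑a ⟨
      ∑ pairs a * ∑ pairs a                     ∎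
      where interchange : ∀ w x y z → w * x * (y * z) ≡ w * y * (x * z)
            interchange = solve-∀
    ∈-pairs : ∀ {ω ω′} → Distinct ω → Distinct ω′ → (ω , ω′) ∈ pairs
    ∈-pairs distinct distinct′ = ∈-cartesianProduct⁺ (∈-distinctTuples⁺ distinct) (∈-distinctTuples⁺ distinct′)
    constant : ConstantTransport j (transports ω₀ ω₀)
    constant distinct distinct′ = cauchySchwarz-tight⇒constant a tight (∈-pairs distinct distinct′) (∈-pairs distinct₀ distinct₀)
    c>0 : 0 < transports ω₀ ω₀
    c>0 = ℕP.n≢0⇒n>0 λ c≡0 → ℕP.<⇒≢ L>0 (begin
      0                     ≡⟨ ℕP.*-zeroʳ M ⟨
      M * 0                 ≡⟨ cong (M *_) c≡0 ⟨
      M * transports ω₀ ω₀  ≡⟨ length-distinctTuples*constant j≤n constant ⟩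
      L                     ∎)

  isDesign⇒squareSum : ∀ {t j} → t ≤ n → IsDesign t Y → j ≤ t → squareSum j ≡ length Y * length Y
  isDesign⇒squareSum t≤n design j≤t = constantTransport⇒squareSum (ℕP.≤-trans j≤t t≤n)
    (proj₂ (constantTransport-downward t≤n (proj₂ (isDesign⇒constantTransport design)) j≤t))

  squareSum⇒isDesign : ∀ {t} → t ≤ n → 0 < length Y → squareSum t ≡ length Y * length Y → IsDesign t Y
  squareSum⇒isDesign t≤n L>0 squareSum≡L² =
    let c , c>0 , constant = squareSum⇒constantTransport t≤n L>0 squareSum≡L² in constantTransport⇒isDesign c>0 constant

-- The dual distance distribution

module _ {r n : ℕ} .{{_ : NonZero r}} where

  θ≡fixedFibres : ∀ (g : W r n) → θ g ≡ ι (fixedFibres g)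
  θ≡fixedFibres g = trans (cong (λ m → ℤ.+ m / r) fixedPoints≡) (+[r*m]/r≡ι[m] r (fixedFibres g))
    where
    fixedPoints≡ : countL {r} {n} (λ p → act g p ≟ₚ p) (points {r} {n}) ≡ r * fixedFibres g
    fixedPoints≡ = trans (length-filter (λ p → act g p ≟ₚ p) points) (∑-points-colourblind _ (λ c c′ i →
      𝟙-cong (act-fixes-colourblind g) (act-fixes-colourblind g) (act g (c , i) ≟ₚ (c , i)) (act g (c′ , i) ≟ₚ (c′ , i))))

  charlier∘θ≡ : ∀ k (g : W r n) → charlier (ι r) k (θ g) ≡ binomialTransform (λ j → ι (fixedTuples j g)) k
  charlier∘θ≡ k g = binomialTransform-cong≤ k λ j _ → begin
    ι r ^ℚ j ℚ.* falling (θ g) j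
      ≡⟨ cong₂ ℚ._*_ (ι-^ r j) (trans (ι-P′ (fixedFibres g) j) (cong (λ x → falling x j) (sym (θ≡fixedFibres g)))) ⟨
    ι (r ^ j) ℚ.* ι (fixedFibres g P′ j)
      ≡⟨ ι-* (r ^ j) (fixedFibres g P′ j) ⟨
    ι (r ^ j * (fixedFibres g P′ j))
      ≡⟨ cong ι (fixedTuples≡ j g) ⟨
    ι (fixedTuples j g) ∎

  dualDist≡ : ∀ (Y : List (W r n)) .{{_ : NonZero (length Y)}} k →
    dualDist r n Y k ≡ (ℤ.+ 1 / length Y) ℚ.* binomialTransform (λ j → ι (∑[ g ∈ quotients Y ] fixedTuples j g)) k
  dualDist≡ Y k = cong ((ℤ.+ 1 / length Y) ℚ.*_) (begin
    sumℚ (concatMap (λ x → map (λ y → charlier (ι r) k (θ (invW x ·W y))) Y) Y)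
      ≡⟨ cong sumℚ (concatMap-map≡cartesianProductWith _ Y Y) ⟩
    sumℚ (cartesianProductWith (λ x y → charlier (ι r) k (θ (invW x ·W y))) Y Y)
      ≡⟨ cong sumℚ (map-cartesianProductWith _ (λ g → charlier (ι r) k (θ g)) Y Y) ⟨
    sumℚ (map (λ g → charlier (ι r) k (θ g)) (quotients Y))
      ≡⟨ cong sumℚ (ListP.map-cong (charlier∘θ≡ k) (quotients Y)) ⟩
    sumℚ (map (λ g → binomialTransform (λ j → ι (fixedTuples j g)) k) (quotients Y))
      ≡⟨ sumℚ-binomialTransform (quotients Y) (λ g j → ι (fixedTuples j g)) k ⟩
    binomialTransform (λ j → sumℚ (map (λ g → ι (fixedTuples j g)) (quotients Y))) k
      ≡⟨ binomialTransform-cong≤ k (λ j _ → ι-∑ (quotients Y) (fixedTuples j)) ⟨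
    binomialTransform (λ j → ι (∑[ g ∈ quotients Y ] fixedTuples j g)) k ∎)

proposition6p4 : (r n : ℕ) .{{_ : NonZero r}} → 1 ≤ n →
    (Y : List (W r n)) → UniqueW Y → .{{_ : NonZero (length Y)}} →
    (t : ℕ) → 1 ≤ t → t ≤ n →
    (IsDesign t Y → (k : ℕ) → 1 ≤ k → k ≤ t → dualDist r n Y k ≡ 0ℚ)
    × (2 * t ≤ n → ((k : ℕ) → 1 ≤ k → k ≤ t → dualDist r n Y k ≡ 0ℚ) → IsDesign t Y)
proposition6p4 r n _ Y _ t _ t≤n = design⇒dualDist≡0 , λ _ → dualDist≡0⇒design
  where
  S : ℕ → ℕ
  S j = ∑[ g ∈ quotients Y ] fixedTuples j g

  S₀ : S 0 ≡ length Y * length Y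
  S₀ = trans (∑-fixedTuples-quotients Y 0) (constantTransport⇒squareSum Y z≤n (λ { {[]} {[]} _ _ → ∑-1 Y }))

  design⇒dualDist≡0 : IsDesign t Y → ∀ k → 1 ≤ k → k ≤ t → dualDist r n Y k ≡ 0ℚ
  design⇒dualDist≡0 design (suc k) _ k<t = begin
    dualDist r n Y (suc k)
      ≡⟨ dualDist≡ Y (suc k) ⟩
    (ℤ.+ 1 / length Y) ℚ.* binomialTransform (ι ∘ S) (suc k)
      ≡⟨ cong ((ℤ.+ 1 / length Y) ℚ.*_) (constant⇒binomialTransform-vanishes k S≡) ⟩
    (ℤ.+ 1 / length Y) ℚ.* 0ℚ
      ≡⟨ ℚP.*-zeroʳ (ℤ.+ 1 / length Y) ⟩
    0ℚ ∎
    where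
    S≡ : ∀ j → j ≤ suc k → ι (S j) ≡ ι (length Y * length Y)
    S≡ j j≤k = cong ι (trans (∑-fixedTuples-quotients Y j) (isDesign⇒squareSum Y t≤n design (ℕP.≤-trans j≤k k<t)))

  dualDist≡0⇒design : (∀ k → 1 ≤ k → k ≤ t → dualDist r n Y k ≡ 0ℚ) → IsDesign t Y
  dualDist≡0⇒design vanishes = squareSum⇒isDesign Y t≤n (>-nonZero⁻¹ (length Y))
    (trans (sym (∑-fixedTuples-quotients Y t))
           (ι-injective (trans (binomialTransform-vanishes⇒constant t transform≡0 t ℕP.≤-refl) (cong ι S₀))))
    where
    transform≡0 : ∀ k → 1 ≤ k → k ≤ t → binomialTransform (ι ∘ S) k ≡ 0ℚ
    transform≡0 k 1≤k k≤t = 1/n*q≡0⇒q≡0 (length Y) _ (trans (sym (dualDist≡ Y k)) (vanishes k 1≤k k≤t))
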